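{- Let $\mathcal{C}(4132)=\operatorname{Av}(2143,3142,4132)$ and let $\mathcal{C}_n(4132)$ denote its permutations of length $n$. Then $$\sum_{n\ge 0}|\mathcal{C}_n(4132)|\,x^n=\frac{2}{1+x+\sqrt{(1-x)(1-5x)}}.$$
   Context: For a set of patterns $T$, $\operatorname{Av}_n(T)$ is the set of permutations of length $n$ avoiding every pattern in $T$, and $\operatorname{Av}(T)=\bigcup_{n\ge 0}\operatorname{Av}_n(T)$. The empty permutation is counted for $n=0$. -}

module Defs where

open import Data.Bool using (Bool; true; false; _∧_; _∨_; not; T)
open import Data.Nat using (ℕ; zero; suc; _∸_; _<ᵇ_; _≡ᵇ_)
open import Data.Integer using (ℤ; +_; -_) renaming (_+_ to _+ℤ_; _*_ to _*ℤ_)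
open import Data.List using (List; []; _∷_; map; upTo; zipWith; length)
open import Data.Bool.ListAction using (all; any)
open import Data.Vec using (Vec; toList)
open import Data.Fin using (Fin; toℕ)
open import Data.Product using (Σ)

subseqs : {A : Set} → List A → List (List A)
subseqs []       = [] ∷ []
subseqs (x ∷ xs) = let r = subseqs xs in map (x ∷_) r Data.List.++ r

_==_ : Bool → Bool → Bool
true  == b = b
false == b = not b

-- Two lists are order-isomorphic: same length and for every pair of
-- positions i < j, (x_i < x_j) ⟺ (y_i < y_j).  (Entries are distinct here.)
orderIso : List ℕ → List ℕ → Bool
orderIso []       []       = true
orderIso []       (_ ∷ _)  = false
orderIso (_ ∷ _)  []       = false
orderIso (x ∷ xs) (y ∷ ys) =
  (length xs ≡ᵇ length ys) ∧
  all (λ b → b) (zipWith (λ x' y' → (x <ᵇ x') == (y <ᵇ y')) xs ys) ∧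
  orderIso xs ys

contains : List ℕ → List ℕ → Bool
contains π σ = any (orderIso π) (subseqs σ)

avoidsAll : List (List ℕ) → List ℕ → Bool
avoidsAll Ps σ = all (λ π → not (contains π σ)) Ps

nodup : List ℕ → Bool
nodup []       = true
nodup (x ∷ xs) = not (any (x ≡ᵇ_) xs) ∧ nodup xs

-- A permutation of length n, in one-line notation, is an injective
-- word of length n over Fin n (values 0..n-1).
word : {n : ℕ} → Vec (Fin n) n → List ℕ
word v = map toℕ (toList v)

isPerm : {n : ℕ} → Vec (Fin n) n → Bool
isPerm v = nodup (word v)

Av : List (List ℕ) → ℕ → Set
Av Ps n = Σ (Vec (Fin n) n) (λ v → T (isPerm v ∧ avoidsAll Ps (word v)))

C4132 : ℕ → Set
C4132 = Av ((2 ∷ 1 ∷ 4 ∷ 3 ∷ []) ∷ (3 ∷ 1 ∷ 4 ∷ 2 ∷ []) ∷ (4 ∷ 1 ∷ 3 ∷ 2 ∷ []) ∷ [])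

Series : Set
Series = ℕ → ℤ

_⊛_ : Series → Series → Series
(f ⊛ g) n = Data.List.foldr _+ℤ_ (+ 0) (map (λ i → f i *ℤ g (n ∸ i)) (upTo (suc n)))

_⊕_ : Series → Series → Series
(f ⊕ g) n = f n +ℤ g n

const : ℤ → Series
const c zero    = c
const c (suc _) = + 0

X : Series
X (suc zero) = + 1
X _          = + 0

scaleX : ℤ → Series
scaleX c (suc zero) = c
scaleX c _          = + 0

disc : Series
disc = (const (+ 1) ⊕ scaleX (- (+ 1))) ⊛ (const (+ 1) ⊕ scaleX (- (+ 5)))

module Submission where

open import Defs
open import Data.Nat using (ℕ)
open import Data.Integer using (ℤ; +_)
open import Data.Fin using (Fin)
open import Data.Product using (Σ; _×_)
open import Function.Bundles using (_↔_)
open import Relation.Binary.PropositionalEquality using (_≡_)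
open import Data.Product using (_,_)
open import Relation.Binary.PropositionalEquality using (refl; trans; cong)

-- The three patterns are exactly the patterns a1cb with c > b, so inserting a new
-- minimum into a permutation of the class keeps it in the class iff the insertion is
-- at the front or before an increasing suffix, and every permutation of length n + 1
-- arises this way from exactly one of length n. Labelling an increasing permutation
-- of length m by (m) and any other by the length (s) of its longest increasing suffix
-- gives the generating tree (m) → (m+1)(1)…(m), (s) → (s)(1)…(s+1). With D the power
-- series satisfying D = 1 + x/(1-x)·D², the subtree below (s) has generating function
-- D^(s+1)/(1-x), and the whole tree F = Σ a(n) xⁿ satisfies (1 - xD)·F = 1. Hence
-- F·(1 + x + S) = 2 for S = 1 - x - 2xD, and S² = (1-x)(1-5x) because
-- (1-x)·D = 1 - x + x·D².


module PowerSeries where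

  open import Data.Nat as ℕ using (ℕ; zero; suc; _<_; _≤_; z≤n; s≤s; _∸_)
  open import Data.Nat.ListAction using (sum)
  open import Data.Nat.ListAction.Properties using (sum-++)
  import Data.Nat.Properties as ℕ
  open import Data.Integer as ℤ using (ℤ; +_; -_; _+_; _*_)
  import Data.Integer.Properties as ℤ
  open import Data.Integer.Tactic.RingSolver using (solve-∀)
  open import Data.Product using (_,_)
  open import Function using (_∘_)
  open import Data.Maybe using (Maybe; just; nothing)
  open import Relation.Nullary using (yes; no)
  open import Relation.Binary.PropositionalEquality
  open import Algebra.Bundles using (CommutativeRing)
  open import Algebra.Solver.Ring.AlmostCommutativeRing
    using (AlmostCommutativeRing; fromCommutativeRing; _-Raw-AlmostCommutative⟶_)
  open import Data.List using ([]; _∷_; foldr; map; applyUpTo; _∷ʳ_)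
  import Data.List.Properties as List

  -- Defs._⊕_ has the default fixity (non-associative, 20), so ⊗ must bind tighter.
  infixl 21 _⊗_
  infix  22 ⊖_
  infixr 23 _^_

  𝟘 : Series
  𝟘 _ = + 0

  𝟙 : Series
  𝟙 = const (+ 1)

  ⊖_ : Series → Series
  (⊖ f) n = - f n

  tail : Series → Series
  tail f n = f (suc n)

  shift : Series → Series
  shift f zero    = + 0
  shift f (suc n) = f n

  _⊗_ : Series → Series → Series
  (f ⊗ g) zero    = f 0 * g 0
  (f ⊗ g) (suc n) = f 0 * g (suc n) + (tail f ⊗ g) n

  ⊕-cong : ∀ {f f′ g g′} → f ≗ f′ → g ≗ g′ → f ⊕ g ≗ f′ ⊕ g′
  ⊕-cong p q n = cong₂ _+_ (p n) (q n)

  ⊗-cong : ∀ {f f′ g g′} → f ≗ f′ → g ≗ g′ → f ⊗ g ≗ f′ ⊗ g′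
  ⊗-cong p q zero    = cong₂ _*_ (p 0) (q 0)
  ⊗-cong p q (suc n) = cong₂ _+_ (cong₂ _*_ (p 0) (q (suc n))) (⊗-cong (p ∘ suc) q n)

  ⊕-congˡ : ∀ f {g g′} → g ≗ g′ → f ⊕ g ≗ f ⊕ g′
  ⊕-congˡ f p n = cong (_+_ (f n)) (p n)

  ⊕-congʳ : ∀ g {f f′} → f ≗ f′ → f ⊕ g ≗ f′ ⊕ g
  ⊕-congʳ g p n = cong (_+ g n) (p n)

  ⊗-congˡ : ∀ f {g g′} → g ≗ g′ → f ⊗ g ≗ f ⊗ g′
  ⊗-congˡ f = ⊗-cong {f} {f} (λ _ → refl)

  ⊗-congʳ : ∀ g {f f′} → f ≗ f′ → f ⊗ g ≗ f′ ⊗ g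
  ⊗-congʳ g p = ⊗-cong {g = g} {g′ = g} p (λ _ → refl)

  ⊗-local : ∀ n {f f′ g g′} → (∀ i → i ≤ n → f i ≡ f′ i) → (∀ i → i ≤ n → g i ≡ g′ i) →
            (f ⊗ g) n ≡ (f′ ⊗ g′) n
  ⊗-local zero    p q = cong₂ _*_ (p 0 z≤n) (q 0 z≤n)
  ⊗-local (suc n) p q = cong₂ _+_ (cong₂ _*_ (p 0 z≤n) (q (suc n) ℕ.≤-refl))
    (⊗-local n (λ i i≤n → p (suc i) (s≤s i≤n)) (λ i i≤n → q i (ℕ.m≤n⇒m≤1+n i≤n)))

  ⊗-distribʳ-⊕ : ∀ f g h → (f ⊕ g) ⊗ h ≗ f ⊗ h ⊕ g ⊗ h
  ⊗-distribʳ-⊕ f g h zero    = ℤ.*-distribʳ-+ (h 0) (f 0) (g 0)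
  ⊗-distribʳ-⊕ f g h (suc n) rewrite ⊗-distribʳ-⊕ (tail f) (tail g) h n =
    lemma (f 0) (g 0) (h (suc n)) ((tail f ⊗ h) n) ((tail g ⊗ h) n)
    where
    lemma : ∀ a b c x y → (a + b) * c + (x + y) ≡ (a * c + x) + (b * c + y)
    lemma = solve-∀

  ⊗-scaleˡ : ∀ c f g → (λ n → c * f n) ⊗ g ≗ (λ n → c * (f ⊗ g) n)
  ⊗-scaleˡ c f g zero    = ℤ.*-assoc c (f 0) (g 0)
  ⊗-scaleˡ c f g (suc n) rewrite ⊗-scaleˡ c (tail f) g n =
    lemma c (f 0) (g (suc n)) ((tail f ⊗ g) n)
    where
    lemma : ∀ c a b x → c * a * b + c * x ≡ c * (a * b + x)
    lemma = solve-∀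

  ⊗-unsnoc : ∀ f g n → (f ⊗ g) (suc n) ≡ (f ⊗ tail g) n + f (suc n) * g 0
  ⊗-unsnoc f g zero    = refl
  ⊗-unsnoc f g (suc n) rewrite ⊗-unsnoc (tail f) g n =
    sym (ℤ.+-assoc (f 0 * g (suc (suc n))) ((tail f ⊗ tail g) n) (f (suc (suc n)) * g 0))

  ⊗-comm : ∀ f g → f ⊗ g ≗ g ⊗ f
  ⊗-comm f g zero    = ℤ.*-comm (f 0) (g 0)
  ⊗-comm f g (suc n) rewrite ⊗-unsnoc f g n | ⊗-comm f (tail g) n =
    trans (ℤ.+-comm ((tail g ⊗ f) n) (f (suc n) * g 0)) (cong (_+ (tail g ⊗ f) n) (ℤ.*-comm (f (suc n)) (g 0)))

  ⊗-assoc : ∀ f g h → (f ⊗ g) ⊗ h ≗ f ⊗ (g ⊗ h)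
  ⊗-assoc f g h zero    = ℤ.*-assoc (f 0) (g 0) (h 0)
  ⊗-assoc f g h (suc n) = begin
    (f 0 * g 0) * h (suc n) + (tail (f ⊗ g) ⊗ h) n
      ≡⟨ cong (λ u → a * b * c + u) (⊗-distribʳ-⊕ (λ k → f 0 * tail g k) (tail f ⊗ g) h n) ⟩
    a * b * c + (((λ k → f 0 * tail g k) ⊗ h) n + ((tail f ⊗ g) ⊗ h) n)
      ≡⟨ cong₂ (λ u v → a * b * c + (u + v)) (⊗-scaleˡ (f 0) (tail g) h n) (⊗-assoc (tail f) g h n) ⟩
    a * b * c + (a * (tail g ⊗ h) n + (tail f ⊗ (g ⊗ h)) n)
      ≡⟨ lemma a b c ((tail g ⊗ h) n) ((tail f ⊗ (g ⊗ h)) n) ⟩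
    a * (b * c + (tail g ⊗ h) n) + (tail f ⊗ (g ⊗ h)) n ∎
    where
    open ≡-Reasoning
    a = f 0
    b = g 0
    c = h (suc n)
    lemma : ∀ a b c x y → a * b * c + (a * x + y) ≡ a * (b * c + x) + y
    lemma = solve-∀

  ⊗-zeroˡ : ∀ f g → (∀ n → f n ≡ + 0) → f ⊗ g ≗ 𝟘
  ⊗-zeroˡ f g f≗0 zero    rewrite f≗0 0 = refl
  ⊗-zeroˡ f g f≗0 (suc n) rewrite f≗0 0 | ⊗-zeroˡ (tail f) g (f≗0 ∘ suc) n = refl

  ⊗-identityˡ : ∀ f → 𝟙 ⊗ f ≗ f
  ⊗-identityˡ f zero    = ℤ.*-identityˡ (f 0)
  ⊗-identityˡ f (suc n) =
    trans (cong₂ _+_ (ℤ.*-identityˡ (f (suc n))) (⊗-zeroˡ (tail (𝟙)) f (λ _ → refl) n))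
          (ℤ.+-identityʳ (f (suc n)))

  ⊗-identityʳ : ∀ f → f ⊗ 𝟙 ≗ f
  ⊗-identityʳ f n = trans (⊗-comm f (𝟙) n) (⊗-identityˡ f n)

  ⊗-distribˡ-⊕ : ∀ f g h → h ⊗ (f ⊕ g) ≗ h ⊗ f ⊕ h ⊗ g
  ⊗-distribˡ-⊕ f g h n = begin
    (h ⊗ (f ⊕ g)) n       ≡⟨ ⊗-comm h (f ⊕ g) n ⟩
    ((f ⊕ g) ⊗ h) n       ≡⟨ ⊗-distribʳ-⊕ f g h n ⟩
    (f ⊗ h ⊕ g ⊗ h) n     ≡⟨ cong₂ _+_ (⊗-comm f h n) (⊗-comm g h n) ⟩
    (h ⊗ f ⊕ h ⊗ g) n     ∎
    where open ≡-Reasoning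

  seriesRing : CommutativeRing _ _
  seriesRing = record
    { Carrier = Series ; _≈_ = _≗_ ; _+_ = _⊕_ ; _*_ = _⊗_ ; -_ = ⊖_ ; 0# = 𝟘 ; 1# = 𝟙
    ; isCommutativeRing = record
      { isRing = record
        { +-isAbelianGroup = record
          { isGroup = record
            { isMonoid = record
              { isSemigroup = record
                { isMagma = record
                  { isEquivalence = record
                    { refl = λ _ → refl ; sym = λ p n → sym (p n) ; trans = λ p q n → trans (p n) (q n) }
                  ; ∙-cong = ⊕-cong }
                ; assoc = λ f g h n → ℤ.+-assoc (f n) (g n) (h n) }
              ; identity = (λ f n → ℤ.+-identityˡ (f n)) , (λ f n → ℤ.+-identityʳ (f n)) }
            ; inverse = (λ f n → ℤ.+-inverseˡ (f n)) , (λ f n → ℤ.+-inverseʳ (f n))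
            ; ⁻¹-cong = λ p n → cong -_ (p n) }
          ; comm = λ f g n → ℤ.+-comm (f n) (g n) }
        ; *-cong = ⊗-cong
        ; *-assoc = ⊗-assoc
        ; *-identity = ⊗-identityˡ , ⊗-identityʳ
        ; distrib = (λ h f g → ⊗-distribˡ-⊕ f g h) , (λ h f g → ⊗-distribʳ-⊕ f g h) }
      ; *-comm = ⊗-comm } }

  const-homomorphism : CommutativeRing.rawRing ℤ.+-*-commutativeRing
                       -Raw-AlmostCommutative⟶ fromCommutativeRing seriesRing
  const-homomorphism = record
    { ⟦_⟧    = const
    ; +-homo = λ a b → λ { zero → refl ; (suc _) → refl }
    ; *-homo = λ a b → λ { zero → refl ; (suc n) → sym (begin
        a * + 0 + (tail (const a) ⊗ const b) n ≡⟨ cong (_+ (tail (const a) ⊗ const b) n) (ℤ.*-zeroʳ a) ⟩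
        + 0 + (tail (const a) ⊗ const b) n     ≡⟨ ℤ.+-identityˡ _ ⟩
        (tail (const a) ⊗ const b) n           ≡⟨ ⊗-zeroˡ (tail (const a)) (const b) (λ _ → refl) n ⟩
        + 0                                    ∎) }
    ; -‿homo = λ a → λ { zero → refl ; (suc _) → refl }
    ; 0-homo = λ { zero → refl ; (suc _) → refl }
    ; 1-homo = λ { zero → refl ; (suc _) → refl }
    }
    where open ≡-Reasoning

  const-≟ : ∀ a b → Maybe (const a ≗ const b)
  const-≟ a b with a ℤ.≟ b
  ... | yes refl = just (λ _ → refl)
  ... | no  _    = nothing

  open import Algebra.Solver.Ring (CommutativeRing.rawRing ℤ.+-*-commutativeRing)
    (fromCommutativeRing seriesRing) const-homomorphism const-≟ public

  ⊛≗⊗ : ∀ f g → f ⊛ g ≗ f ⊗ g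
  ⊛≗⊗ f g zero    = ℤ.+-identityʳ (f 0 * g 0)
  ⊛≗⊗ f g (suc n) = cong (_+_ (f 0 * g (suc n))) (begin
    foldr _+_ (+ 0) (map (λ i → f i * g (suc n ∸ i)) (applyUpTo suc (suc n)))
      ≡⟨ cong (foldr _+_ (+ 0)) (List.map-applyUpTo suc (λ i → f i * g (suc n ∸ i)) (suc n)) ⟩
    foldr _+_ (+ 0) (applyUpTo (λ i → tail f i * g (n ∸ i)) (suc n))
      ≡⟨ cong (foldr _+_ (+ 0)) (List.map-upTo (λ i → tail f i * g (n ∸ i)) (suc n)) ⟨
    (tail f ⊛ g) n
      ≡⟨ ⊛≗⊗ (tail f) g n ⟩
    (tail f ⊗ g) n ∎)
    where open ≡-Reasoning

  X⊗≗shift : ∀ f → X ⊗ f ≗ shift f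
  X⊗≗shift f zero    = refl
  X⊗≗shift f (suc n) = begin
    + 0 * f (suc n) + (tail X ⊗ f) n ≡⟨ ℤ.+-identityˡ _ ⟩
    (tail X ⊗ f) n                   ≡⟨ ⊗-congʳ f tail-X n ⟩
    (𝟙 ⊗ f) n                        ≡⟨ ⊗-identityˡ f n ⟩
    f n                              ∎
    where
    open ≡-Reasoning
    tail-X : tail X ≗ 𝟙
    tail-X zero    = refl
    tail-X (suc _) = refl

  scaleX≗const⊗X : ∀ c → scaleX c ≗ const c ⊗ X
  scaleX≗const⊗X c n = sym (trans (⊗-comm (const c) X n) (trans (X⊗≗shift (const c) n) (shift-const n)))
    where
    shift-const : ∀ n → shift (const c) n ≡ scaleX c n
    shift-const zero          = refl
    shift-const (suc zero)    = refl
    shift-const (suc (suc n)) = refl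

  ⊗-zeroʳ : ∀ f → f ⊗ 𝟘 ≗ 𝟘
  ⊗-zeroʳ f n = trans (⊗-comm f 𝟘 n) (⊗-zeroˡ 𝟘 f (λ _ → refl) n)

  _^_ : Series → ℕ → Series
  f ^ zero  = 𝟙
  f ^ suc t = f ⊗ f ^ t

  geometric : Series
  geometric _ = + 1

  geometric-equation : geometric ≗ 𝟙 ⊕ X ⊗ geometric
  geometric-equation zero    = refl
  geometric-equation (suc n) = sym (cong (_+_ (+ 0)) (X⊗≗shift geometric (suc n)))

  Σ< : ℕ → (ℕ → Series) → Series
  Σ< zero    f = 𝟘
  Σ< (suc t) f = Σ< t f ⊕ f t

  Σ<-coefficient : ∀ t (f : ℕ → Series) (h : ℕ → ℕ) k → (∀ j → f j k ≡ + h j) →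
                   Σ< t f k ≡ + sum (applyUpTo h t)
  Σ<-coefficient zero    f h k f≡h = refl
  Σ<-coefficient (suc t) f h k f≡h = begin
    Σ< t f k + f t k                           ≡⟨ cong₂ _+_ (Σ<-coefficient t f h k f≡h) (f≡h t) ⟩
    + sum (applyUpTo h t) + + h t              ≡⟨ ℤ.pos-+ (sum (applyUpTo h t)) (h t) ⟨
    + (sum (applyUpTo h t) ℕ.+ h t)            ≡⟨ cong (λ m → + (sum (applyUpTo h t) ℕ.+ m)) (ℕ.+-identityʳ (h t)) ⟨
    + (sum (applyUpTo h t) ℕ.+ sum (h t ∷ [])) ≡⟨ cong +_ (sum-++ (applyUpTo h t) (h t ∷ [])) ⟨
    + sum (applyUpTo h t ∷ʳ h t)               ≡⟨ cong (+_ ∘ sum) (List.applyUpTo-∷ʳ h t) ⟩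
    + sum (applyUpTo h (suc t))                ∎
    where open ≡-Reasoning

  ⊗-distribˡ-Σ< : ∀ g t f → g ⊗ Σ< t f ≗ Σ< t (λ j → g ⊗ f j)
  ⊗-distribˡ-Σ< g zero    f = ⊗-zeroʳ g
  ⊗-distribˡ-Σ< g (suc t) f n =
    trans (⊗-distribˡ-⊕ (Σ< t f) (f t) g n) (cong (_+ (g ⊗ f t) n) (⊗-distribˡ-Σ< g t f n))

  𝟙⊕X⊗-coefficient-zero : ∀ f → (𝟙 ⊕ X ⊗ f) 0 ≡ + 1
  𝟙⊕X⊗-coefficient-zero f = cong (_+_ (+ 1)) (X⊗≗shift f 0)

  𝟙⊕X⊗-coefficient-suc : ∀ f k → (𝟙 ⊕ X ⊗ f) (suc k) ≡ f k
  𝟙⊕X⊗-coefficient-suc f k = trans (cong (_+_ (+ 0)) (X⊗≗shift f (suc k))) (ℤ.+-identityˡ (f k))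

  𝟙⊕X⊗-cong : ∀ {f g} → f ≗ g → 𝟙 ⊕ X ⊗ f ≗ 𝟙 ⊕ X ⊗ g
  𝟙⊕X⊗-cong = ⊕-congˡ 𝟙 ∘ ⊗-congˡ X

  X-divisible≗𝟘 : (E : ℕ → Series) → (∀ t → E t ≗ X ⊗ E (suc t)) → ∀ t → E t ≗ 𝟘
  X-divisible≗𝟘 E E≗X⊗E t zero    = trans (E≗X⊗E t 0) (X⊗≗shift (E (suc t)) 0)
  X-divisible≗𝟘 E E≗X⊗E t (suc k) =
    trans (E≗X⊗E t (suc k)) (trans (X⊗≗shift (E (suc t)) (suc k)) (X-divisible≗𝟘 E E≗X⊗E (suc t) k))

  -- For a causal operator, coefficient k of the approximants no longer changes from
  -- the (k + 1)-st approximant on; collecting these stable coefficients gives a fixed point.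
  Causal : (Series → Series) → Set
  Causal Φ = ∀ {f g} k → (∀ i → i < k → f i ≡ g i) → Φ f k ≡ Φ g k

  approximant : (Series → Series) → ℕ → Series
  approximant Φ zero    = 𝟘
  approximant Φ (suc m) = Φ (approximant Φ m)

  fixpoint : (Series → Series) → Series
  fixpoint Φ k = approximant Φ (suc k) k

  module _ {Φ : Series → Series} (causal : Causal Φ) where

    approximant-stable : ∀ m k → k < m → approximant Φ m k ≡ approximant Φ (suc m) k
    approximant-stable (suc m) k k<m =
      causal k (λ i i<k → approximant-stable m i (ℕ.<-≤-trans i<k (ℕ.≤-pred k<m)))

    approximant-converges : ∀ d k → approximant Φ (d ℕ.+ suc k) k ≡ fixpoint Φ k
    approximant-converges zero    k = refl
    approximant-converges (suc d) k =
      trans (sym (approximant-stable (d ℕ.+ suc k) k (ℕ.m≤n+m (suc k) d))) (approximant-converges d k)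

    fixpoint-unfold : fixpoint Φ ≗ Φ (fixpoint Φ)
    fixpoint-unfold k = causal k λ i i<k →
      trans (cong (λ m → approximant Φ m i) (sym (ℕ.m∸n+n≡m i<k)))
            (approximant-converges (k ∸ suc i) i)

module Lists where

  open import Data.Bool using (Bool; true; false; _∧_; _∨_; not; T)
  import Data.Bool.Properties as Bool
  open import Data.Bool.ListAction using (all; any; or)
  open import Data.Nat as ℕ using (ℕ; zero; suc; _<ᵇ_; _≡ᵇ_; _<_; z≤n; s≤s; _+_)
  import Data.Nat.Properties as ℕ
  open import Data.Nat.ListAction using (sum)
  open import Data.Nat.ListAction.Properties using (sum-++)
  open import Data.List as List using (List; []; _∷_; map; _++_; length; drop; applyUpTo; concatMap)
  import Data.List.Properties as List
  open import Data.List.Membership.Propositional using (_∈_)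
  import Data.List.Membership.Propositional.Properties as ∈
  open import Data.List.Relation.Unary.Any as Any using ()
  import Data.List.Relation.Unary.Any.Properties as AnyP
  import Data.List.Relation.Unary.All as All
  import Data.List.Relation.Unary.AllPairs as AllPairs
  open import Data.List.Relation.Unary.Unique.Propositional using (Unique)
  open import Data.Fin using (Fin; zero; suc)
  open import Data.Product using (Σ; _,_)
  open import Data.Empty using (⊥-elim)
  open import Function using (_∘_; _↔_; mk↔ₛ′)
  open import Relation.Binary.PropositionalEquality

  private variable
    A B : Set

  ∨-not : ∀ a b → not a ∨ not b ≡ not (a ∧ b)
  ∨-not true  b = refl
  ∨-not false b = refl

  not-∨ : ∀ a b → not (a ∨ b) ≡ not a ∧ not b
  not-∨ true  b = refl
  not-∨ false b = refl

  ≮ᵇ-<ᵇ-trans : ∀ x v w → (x <ᵇ v) ≡ false → (x <ᵇ w) ≡ true → (v <ᵇ w) ≡ true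
  ≮ᵇ-<ᵇ-trans x v w x≮v x<w =
    T⇒≡true (ℕ.<⇒<ᵇ (ℕ.≤-<-trans v≤x (ℕ.<ᵇ⇒< x w (subst T (sym x<w) _))))
    where
    T⇒≡true : ∀ {b} → T b → b ≡ true
    T⇒≡true {true} _ = refl
    v≤x = ℕ.≮⇒≥ (λ x<v → subst T x≮v (ℕ.<⇒<ᵇ x<v))

  any-++ : ∀ (f : A → Bool) xs ys → any f (xs ++ ys) ≡ any f xs ∨ any f ys
  any-++ f []       ys = refl
  any-++ f (x ∷ xs) ys = trans (cong (f x ∨_) (any-++ f xs ys)) (sym (Bool.∨-assoc (f x) _ _))

  any-map : ∀ (f : B → Bool) (g : A → B) xs → any f (map g xs) ≡ any (f ∘ g) xs
  any-map f g xs = cong or (sym (List.map-∘ xs))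

  any-cong : ∀ {f g : A → Bool} → (∀ x → f x ≡ g x) → ∀ xs → any f xs ≡ any g xs
  any-cong f≗g xs = cong or (List.map-cong f≗g xs)

  any-false : ∀ (f : A → Bool) → (∀ x → f x ≡ false) → ∀ xs → any f xs ≡ false
  any-false f f≗false []       = refl
  any-false f f≗false (x ∷ xs) = cong₂ _∨_ (f≗false x) (any-false f f≗false xs)

  any-∨ : ∀ (f g : A → Bool) xs → any (λ x → f x ∨ g x) xs ≡ any f xs ∨ any g xs
  any-∨ f g []       = refl
  any-∨ f g (x ∷ xs) rewrite any-∨ f g xs = lemma (f x) (g x) (any f xs) (any g xs)
    where
    lemma : ∀ a b c d → (a ∨ b) ∨ (c ∨ d) ≡ (a ∨ c) ∨ (b ∨ d)
    lemma true  b     c     d = refl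
    lemma false true  c     d = sym (Bool.∨-zeroʳ c)
    lemma false false c     d = refl

  any-subseqs-∷ : ∀ (f : List A → Bool) x xs →
                  any f (subseqs (x ∷ xs)) ≡ any (f ∘ (x ∷_)) (subseqs xs) ∨ any f (subseqs xs)
  any-subseqs-∷ f x xs = trans (any-++ f (map (x ∷_) (subseqs xs)) (subseqs xs))
                               (cong (_∨ any f (subseqs xs)) (any-map f (x ∷_) (subseqs xs)))

  subseqs-map : ∀ (g : A → B) xs → subseqs (map g xs) ≡ map (map g) (subseqs xs)
  subseqs-map g []       = refl
  subseqs-map g (x ∷ xs) rewrite subseqs-map g xs
    | List.map-++ (map g) (map (x ∷_) (subseqs xs)) (subseqs xs)
    | sym (List.map-∘ {g = map g} {f = x ∷_} (subseqs xs))
    | sym (List.map-∘ {g = g x ∷_} {f = map g} (subseqs xs)) = refl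

  any-subseqs-only-[] : ∀ (f : List A → Bool) {c} → f [] ≡ c → (∀ x s → f (x ∷ s) ≡ false) →
                        ∀ xs → any f (subseqs xs) ≡ c
  any-subseqs-only-[] f f[] f∷ []       = trans (Bool.∨-identityʳ (f [])) f[]
  any-subseqs-only-[] f f[] f∷ (x ∷ xs) =
    trans (any-subseqs-∷ f x xs)
          (cong₂ _∨_ (any-false (f ∘ (x ∷_)) (f∷ x) (subseqs xs)) (any-subseqs-only-[] f f[] f∷ xs))

  increasing : List ℕ → Bool
  increasing []      = true
  increasing (a ∷ l) = all (a <ᵇ_) l ∧ increasing l

  inversion : List ℕ → Bool
  inversion (v ∷ w ∷ []) = not (v <ᵇ w)
  inversion _            = false

  any-inversion-subseqs : ∀ l → any inversion (subseqs l) ≡ not (increasing l)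
  any-inversion-subseqs []      = refl
  any-inversion-subseqs (a ∷ l) = begin
    any inversion (subseqs (a ∷ l))                                     ≡⟨ any-subseqs-∷ inversion a l ⟩
    any (inversion ∘ (a ∷_)) (subseqs l) ∨ any inversion (subseqs l)
      ≡⟨ cong₂ _∨_ (headed a l) (any-inversion-subseqs l) ⟩
    not (all (a <ᵇ_) l) ∨ not (increasing l)                            ≡⟨ ∨-not (all (a <ᵇ_) l) (increasing l) ⟩
    not (increasing (a ∷ l))                                            ∎
    where
    open ≡-Reasoning
    headed : ∀ a l → any (inversion ∘ (a ∷_)) (subseqs l) ≡ not (all (a <ᵇ_) l)
    headed a []      = refl
    headed a (b ∷ l) = trans (any-subseqs-∷ (inversion ∘ (a ∷_)) b l)
      (trans (cong₂ _∨_ (any-subseqs-only-[] (λ s → inversion (a ∷ b ∷ s)) refl (λ _ _ → refl) l)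
                        (headed a l))
             (∨-not (a <ᵇ b) (all (a <ᵇ_) l)))

  increasing-drop : ∀ q l → increasing l ≡ true → increasing (drop q l) ≡ true
  increasing-drop zero    l       inc = inc
  increasing-drop (suc q) []      inc = refl
  increasing-drop (suc q) (a ∷ l) inc = increasing-drop q l (Bool.∧-conicalʳ (all (a <ᵇ_) l) (increasing l) inc)

  all-<ᵇ-map-suc : ∀ a l → all (suc a <ᵇ_) (map suc l) ≡ all (a <ᵇ_) l
  all-<ᵇ-map-suc a []      = refl
  all-<ᵇ-map-suc a (x ∷ l) = cong ((a <ᵇ x) ∧_) (all-<ᵇ-map-suc a l)

  increasing-map-suc : ∀ u → increasing (map suc u) ≡ increasing u
  increasing-map-suc []      = refl
  increasing-map-suc (a ∷ l) = cong₂ _∧_ (all-<ᵇ-map-suc a l) (increasing-map-suc l)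

  insertAt′ : List A → ℕ → A → List A
  insertAt′ xs       zero    v = v ∷ xs
  insertAt′ []       (suc q) v = v ∷ []
  insertAt′ (x ∷ xs) (suc q) v = x ∷ insertAt′ xs q v

  any-subseqs-insertAt′ : ∀ (R : List A → Bool) v → (∀ s t → R (s ++ v ∷ t) ≡ false) →
                          ∀ w q → any R (subseqs (insertAt′ w q v)) ≡ any R (subseqs w)
  any-subseqs-insertAt′ R v R-v w zero = trans (any-subseqs-∷ R v w)
    (cong (_∨ any R (subseqs w)) (any-false (R ∘ (v ∷_)) (R-v []) (subseqs w)))
  any-subseqs-insertAt′ R v R-v [] (suc q) = cong (_∨ R [] ∨ false) (R-v [] [])
  any-subseqs-insertAt′ R v R-v (y ∷ w) (suc q) = begin
    any R (subseqs (y ∷ insertAt′ w q v))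
      ≡⟨ any-subseqs-∷ R y (insertAt′ w q v) ⟩
    any (R ∘ (y ∷_)) (subseqs (insertAt′ w q v)) ∨ any R (subseqs (insertAt′ w q v))
      ≡⟨ cong₂ _∨_ (any-subseqs-insertAt′ (R ∘ (y ∷_)) v (λ s → R-v (y ∷ s)) w q)
                   (any-subseqs-insertAt′ R v R-v w q) ⟩
    any (R ∘ (y ∷_)) (subseqs w) ∨ any R (subseqs w)
      ≡⟨ any-subseqs-∷ R y w ⟨
    any R (subseqs (y ∷ w)) ∎
    where open ≡-Reasoning

  any-insertAt′ : ∀ (f : A → Bool) xs q v → any f (insertAt′ xs q v) ≡ f v ∨ any f xs
  any-insertAt′ f xs       zero    v = refl
  any-insertAt′ f []       (suc q) v = refl
  any-insertAt′ f (x ∷ xs) (suc q) v rewrite any-insertAt′ f xs q v = lemma (f x) (f v) (any f xs)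
    where
    lemma : ∀ a b c → a ∨ (b ∨ c) ≡ b ∨ (a ∨ c)
    lemma a b c = trans (sym (Bool.∨-assoc a b c)) (trans (cong (_∨ c) (Bool.∨-comm a b)) (Bool.∨-assoc b a c))

  nodup-map-suc : ∀ l → nodup (map suc l) ≡ nodup l
  nodup-map-suc []      = refl
  nodup-map-suc (x ∷ l) rewrite any-map (suc x ≡ᵇ_) suc l | nodup-map-suc l = refl

  nodup-insert-min : ∀ q l → nodup (insertAt′ (map suc l) q 0) ≡ nodup l
  nodup-insert-min zero    l rewrite any-map (0 ≡ᵇ_) suc l | any-false (λ x → 0 ≡ᵇ suc x) (λ _ → refl) l =
    nodup-map-suc l
  nodup-insert-min (suc q) []      = refl
  nodup-insert-min (suc q) (y ∷ l) rewrite any-insertAt′ (suc y ≡ᵇ_) (map suc l) q 0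
    | any-map (suc y ≡ᵇ_) suc l | nodup-insert-min q l = refl

  applyUpTo-cong : ∀ k (f g : ℕ → A) → (∀ j → j < k → f j ≡ g j) →
                   applyUpTo f k ≡ applyUpTo g k
  applyUpTo-cong zero    f g f≗g = refl
  applyUpTo-cong (suc k) f g f≗g =
    cong₂ _∷_ (f≗g 0 (s≤s z≤n)) (applyUpTo-cong k (f ∘ suc) (g ∘ suc) (λ j j<k → f≗g (suc j) (s≤s j<k)))

  sum-concatMap : ∀ (h : B → ℕ) (f : A → List B) xs →
                  sum (map h (concatMap f xs)) ≡ sum (map (λ x → sum (map h (f x))) xs)
  sum-concatMap h f []       = refl
  sum-concatMap h f (x ∷ xs) = begin
    sum (map h (f x ++ concatMap f xs))              ≡⟨ cong sum (List.map-++ h (f x) (concatMap f xs)) ⟩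
    sum (map h (f x) ++ map h (concatMap f xs))      ≡⟨ sum-++ (map h (f x)) (map h (concatMap f xs)) ⟩
    sum (map h (f x)) + sum (map h (concatMap f xs))      ≡⟨ cong (_+_ (sum (map h (f x)))) (sum-concatMap h f xs) ⟩
    sum (map h (f x)) + sum (map (λ x → sum (map h (f x))) xs) ∎
    where open ≡-Reasoning

  Unique⇒lookup-injective : ∀ (xs : List A) → Unique xs →
                            ∀ i j → List.lookup xs i ≡ List.lookup xs j → i ≡ j
  Unique⇒lookup-injective (x ∷ xs) (AllPairs._∷_ x∉ u) zero    zero    e = refl
  Unique⇒lookup-injective (x ∷ xs) (AllPairs._∷_ x∉ u) zero    (suc j) e =
    ⊥-elim (All.lookup x∉ (∈.∈-lookup j) e)
  Unique⇒lookup-injective (x ∷ xs) (AllPairs._∷_ x∉ u) (suc i) zero    e =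
    ⊥-elim (All.lookup x∉ (∈.∈-lookup i) (sym e))
  Unique⇒lookup-injective (x ∷ xs) (AllPairs._∷_ x∉ u) (suc i) (suc j) e =
    cong suc (Unique⇒lookup-injective xs u i j e)

  enumeration↔ : ∀ {A : Set} {P : A → Set} (xs : List A) → Unique xs →
                 (∀ x → x ∈ xs → P x) → (∀ x → P x → x ∈ xs) → (∀ x (p q : P x) → p ≡ q) →
                 Fin (length xs) ↔ Σ A P
  enumeration↔ {A} {P} xs unique sound complete irrelevant = mk↔ₛ′ to from to∘from from∘to
    where
    to : Fin (length xs) → Σ A P
    to i = List.lookup xs i , sound (List.lookup xs i) (∈.∈-lookup i)
    from : Σ A P → Fin (length xs)
    from (x , px) = Any.index (complete x px)
    to∘from : ∀ y → to (from y) ≡ y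
    to∘from (x , px) = pair-≡ (sym (AnyP.lookup-index (complete x px)))
      where
      pair-≡ : ∀ {y py} → y ≡ x → (y , py) ≡ (x , px)
      pair-≡ {py = py} refl = cong (x ,_) (irrelevant x py px)
    from∘to : ∀ i → from (to i) ≡ i
    from∘to i = Unique⇒lookup-injective xs unique _ i (sym (AnyP.lookup-index (complete _ _)))

module Patterns where

  open import Data.Bool using (Bool; true; false; _∧_; _∨_; not)
  import Data.Bool.Properties as Bool
  open import Data.Bool.ListAction using (any)
  open import Data.Nat using (ℕ; zero; suc; _<ᵇ_; _≡ᵇ_; _≤_; s≤s)
  open import Data.List using (List; []; _∷_; map; _++_; length; drop; zipWith)
  import Data.List.Properties as List
  open import Function using (_∘_)
  open import Relation.Binary.PropositionalEquality
  open Lists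

  occurrence : List ℕ → Bool
  occurrence s =
    orderIso (2 ∷ 1 ∷ 4 ∷ 3 ∷ []) s ∨ orderIso (3 ∷ 1 ∷ 4 ∷ 2 ∷ []) s ∨ orderIso (4 ∷ 1 ∷ 3 ∷ 2 ∷ []) s

  avoids : List ℕ → Bool
  avoids w = not (any occurrence (subseqs w))

  forbidden : List (List ℕ)
  forbidden = (2 ∷ 1 ∷ 4 ∷ 3 ∷ []) ∷ (3 ∷ 1 ∷ 4 ∷ 2 ∷ []) ∷ (4 ∷ 1 ∷ 3 ∷ 2 ∷ []) ∷ []

  avoidsAll≡avoids : ∀ w → avoidsAll forbidden w ≡ avoids w
  avoidsAll≡avoids w = trans (lemma (any o₁ S) (any o₂ S) (any o₃ S))
    (cong not (sym (trans (any-∨ o₁ _ S) (cong (any o₁ S ∨_) (any-∨ o₂ o₃ S)))))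
    where
    lemma : ∀ a b c → not a ∧ not b ∧ not c ∧ true ≡ not (a ∨ b ∨ c)
    lemma true  b     c     = refl
    lemma false true  c     = refl
    lemma false false true  = refl
    lemma false false false = refl
    S  = subseqs w
    o₁ = orderIso (2 ∷ 1 ∷ 4 ∷ 3 ∷ [])
    o₂ = orderIso (3 ∷ 1 ∷ 4 ∷ 2 ∷ [])
    o₃ = orderIso (4 ∷ 1 ∷ 3 ∷ 2 ∷ [])

  -- The part of the normal form of occurrence (x ∷ u ∷ v ∷ w ∷ []) shared by the three patterns.
  private
    tail-normal : ∀ p q r → (p ∧ q ∧ true) ∧ (not r ∧ true) ∧ true ≡ p ∧ q ∧ not r
    tail-normal p q r rewrite Bool.∧-identityʳ q | Bool.∧-identityʳ (not r) | Bool.∧-identityʳ (not r) =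
      Bool.∧-assoc p q (not r)

  -- The three patterns are exactly the patterns a1cb with c > b: an occurrence is
  -- a second entry below the other three, followed by a descent.
  occurrence-shape : ∀ x u v w →
    occurrence (x ∷ u ∷ v ∷ w ∷ []) ≡ not (x <ᵇ u) ∧ (u <ᵇ v) ∧ (u <ᵇ w) ∧ not (v <ᵇ w)
  occurrence-shape x u v w with x <ᵇ u
  ... | true  = refl
  ... | false with x <ᵇ v in x<v | x <ᵇ w in x<w
  ...   | true  | true  = trans (Bool.∨-identityʳ _) (tail-normal (u <ᵇ v) (u <ᵇ w) (v <ᵇ w))
  ...   | true  | false = trans (Bool.∨-identityʳ _) (tail-normal (u <ᵇ v) (u <ᵇ w) (v <ᵇ w))
  ...   | false | false = tail-normal (u <ᵇ v) (u <ᵇ w) (v <ᵇ w)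
  ...   | false | true  = sym (begin
    (u <ᵇ v) ∧ (u <ᵇ w) ∧ not (v <ᵇ w)
      ≡⟨ cong (λ r → (u <ᵇ v) ∧ (u <ᵇ w) ∧ not r) (≮ᵇ-<ᵇ-trans x v w x<v x<w) ⟩
    (u <ᵇ v) ∧ (u <ᵇ w) ∧ false        ≡⟨ cong ((u <ᵇ v) ∧_) (Bool.∧-zeroʳ (u <ᵇ w)) ⟩
    (u <ᵇ v) ∧ false                   ≡⟨ Bool.∧-zeroʳ (u <ᵇ v) ⟩
    false                              ∎)
    where open ≡-Reasoning

  private
    zipWith-map-suc : ∀ (f : ℕ → ℕ → Bool) xs ys →
                      zipWith f xs (map suc ys) ≡ zipWith (λ x y → f x (suc y)) xs ys
    zipWith-map-suc f []       ys       = refl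
    zipWith-map-suc f (x ∷ xs) []       = refl
    zipWith-map-suc f (x ∷ xs) (y ∷ ys) = cong (f x (suc y) ∷_) (zipWith-map-suc f xs ys)

  orderIso-map-suc : ∀ π s → orderIso π (map suc s) ≡ orderIso π s
  orderIso-map-suc []       []       = refl
  orderIso-map-suc []       (_ ∷ _)  = refl
  orderIso-map-suc (_ ∷ _)  []       = refl
  orderIso-map-suc (a ∷ π) (y ∷ ys) rewrite List.length-map suc ys
    | zipWith-map-suc (λ x′ y′ → (a <ᵇ x′) == (suc y <ᵇ y′)) π ys | orderIso-map-suc π ys = refl

  occurrence-map-suc : ∀ s → occurrence (map suc s) ≡ occurrence s
  occurrence-map-suc s rewrite orderIso-map-suc (2 ∷ 1 ∷ 4 ∷ 3 ∷ []) s
    | orderIso-map-suc (3 ∷ 1 ∷ 4 ∷ 2 ∷ []) s | orderIso-map-suc (4 ∷ 1 ∷ 3 ∷ 2 ∷ []) s = refl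

  any-occurrence-map-suc : ∀ (f g : List ℕ → List ℕ) → (∀ s → f (map suc s) ≡ map suc (g s)) →
    ∀ w → any (occurrence ∘ f) (subseqs (map suc w)) ≡ any (occurrence ∘ g) (subseqs w)
  any-occurrence-map-suc f g f-suc w = begin
    any (occurrence ∘ f) (subseqs (map suc w))        ≡⟨ cong (any (occurrence ∘ f)) (subseqs-map suc w) ⟩
    any (occurrence ∘ f) (map (map suc) (subseqs w))  ≡⟨ any-map (occurrence ∘ f) (map suc) (subseqs w) ⟩
    any (occurrence ∘ f ∘ map suc) (subseqs w)        ≡⟨ any-cong (λ s → trans (cong occurrence (f-suc s))
                                                                            (occurrence-map-suc (g s))) (subseqs w) ⟩
    any (occurrence ∘ g) (subseqs w)                  ∎
    where open ≡-Reasoning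

  avoids-∷ : ∀ x w → avoids (x ∷ w) ≡ not (any (occurrence ∘ (x ∷_)) (subseqs w)) ∧ avoids w
  avoids-∷ x w = trans (cong not (any-subseqs-∷ occurrence x w))
    (not-∨ (any (occurrence ∘ (x ∷_)) (subseqs w)) (any occurrence (subseqs w)))

  occurrence-min-first : ∀ t → occurrence (0 ∷ map suc t) ≡ false
  occurrence-min-first []                    = refl
  occurrence-min-first (_ ∷ [])              = refl
  occurrence-min-first (_ ∷ _ ∷ [])          = refl
  occurrence-min-first (_ ∷ _ ∷ _ ∷ [])      = refl
  occurrence-min-first (_ ∷ _ ∷ _ ∷ _ ∷ _)   = refl

  occurrence-min-late : ∀ y z s t → occurrence (y ∷ z ∷ s ++ 0 ∷ t) ≡ false
  occurrence-min-late y z []               []            = refl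
  occurrence-min-late y z []               (w ∷ [])      = trans (occurrence-shape y z 0 w) (Bool.∧-zeroʳ _)
  occurrence-min-late y z []               (_ ∷ _ ∷ _)   = refl
  occurrence-min-late y z (v ∷ [])         []            = trans (occurrence-shape y z v 0)
    (trans (cong (not (y <ᵇ z) ∧_) (Bool.∧-zeroʳ (z <ᵇ v))) (Bool.∧-zeroʳ _))
  occurrence-min-late y z (v ∷ [])         (_ ∷ _)       = refl
  occurrence-min-late y z (_ ∷ _ ∷ [])     t             = refl
  occurrence-min-late y z (_ ∷ _ ∷ _ ∷ _)  t             = refl

  occurrence-after-min : ∀ y s → occurrence (suc y ∷ 0 ∷ map suc s) ≡ inversion s
  occurrence-after-min y []               = refl
  occurrence-after-min y (_ ∷ [])         = refl
  occurrence-after-min y (v ∷ w ∷ [])     = occurrence-shape (suc y) 0 (suc v) (suc w)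
  occurrence-after-min y (_ ∷ _ ∷ _ ∷ _)  = refl

  -- An occurrence that starts above the inserted minimum 0 and uses it must use it
  -- as its second entry, and is then completed by an inversion after it.
  any-occurrence-insert-min : ∀ y q l → q ≤ length l →
    any (occurrence ∘ (suc y ∷_)) (subseqs (insertAt′ (map suc l) q 0))
    ≡ any (occurrence ∘ (suc y ∷_)) (subseqs (map suc l)) ∨ not (increasing (drop q l))
  any-occurrence-insert-min y zero l _ = begin
    any (occurrence ∘ (suc y ∷_)) (subseqs (0 ∷ map suc l))
      ≡⟨ any-subseqs-∷ (occurrence ∘ (suc y ∷_)) 0 (map suc l) ⟩
    any (occurrence ∘ (suc y ∷_) ∘ (0 ∷_)) (subseqs (map suc l)) ∨ b
      ≡⟨ cong (_∨ b) (trans (cong (any _) (subseqs-map suc l))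
                            (any-map (occurrence ∘ (suc y ∷_) ∘ (0 ∷_)) (map suc) (subseqs l))) ⟩
    any (occurrence ∘ (suc y ∷_) ∘ (0 ∷_) ∘ map suc) (subseqs l) ∨ b
      ≡⟨ cong (_∨ b) (trans (any-cong (occurrence-after-min y) (subseqs l)) (any-inversion-subseqs l)) ⟩
    not (increasing l) ∨ b
      ≡⟨ Bool.∨-comm (not (increasing l)) b ⟩
    b ∨ not (increasing l) ∎
    where
    open ≡-Reasoning
    b = any (occurrence ∘ (suc y ∷_)) (subseqs (map suc l))
  any-occurrence-insert-min y (suc q) (z ∷ l) (s≤s q≤l) = begin
    any (occurrence ∘ (suc y ∷_)) (subseqs (suc z ∷ insertAt′ (map suc l) q 0))
      ≡⟨ any-subseqs-∷ (occurrence ∘ (suc y ∷_)) (suc z) (insertAt′ (map suc l) q 0) ⟩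
    any (occurrence ∘ (suc y ∷_) ∘ (suc z ∷_)) (subseqs (insertAt′ (map suc l) q 0))
      ∨ any (occurrence ∘ (suc y ∷_)) (subseqs (insertAt′ (map suc l) q 0))
      ≡⟨ cong₂ _∨_ (any-subseqs-insertAt′ (occurrence ∘ (suc y ∷_) ∘ (suc z ∷_)) 0
                      (occurrence-min-late (suc y) (suc z)) (map suc l) q)
                   (any-occurrence-insert-min y q l q≤l) ⟩
    c ∨ (b ∨ not (increasing (drop q l)))
      ≡⟨ Bool.∨-assoc c b (not (increasing (drop q l))) ⟨
    (c ∨ b) ∨ not (increasing (drop q l))
      ≡⟨ cong (_∨ not (increasing (drop q l))) (any-subseqs-∷ (occurrence ∘ (suc y ∷_)) (suc z) (map suc l)) ⟨
    any (occurrence ∘ (suc y ∷_)) (subseqs (map suc (z ∷ l))) ∨ not (increasing (drop q l)) ∎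
    where
    open ≡-Reasoning
    b = any (occurrence ∘ (suc y ∷_)) (subseqs (map suc l))
    c = any (occurrence ∘ (suc y ∷_) ∘ (suc z ∷_)) (subseqs (map suc l))

  avoids-insert-min : ∀ q l → q ≤ length l →
    avoids (insertAt′ (map suc l) q 0) ≡ avoids l ∧ ((q ≡ᵇ 0) ∨ increasing (drop q l))
  avoids-insert-min zero l _ = begin
    avoids (0 ∷ map suc l)
      ≡⟨ avoids-∷ 0 (map suc l) ⟩
    not (any (occurrence ∘ (0 ∷_)) (subseqs (map suc l))) ∧ avoids (map suc l)
      ≡⟨ cong₂ (λ a b → not a ∧ not b) min-first (any-occurrence-map-suc (λ s → s) (λ s → s) (λ _ → refl) l) ⟩
    avoids l
      ≡⟨ Bool.∧-identityʳ (avoids l) ⟨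
    avoids l ∧ true ∎
    where
    open ≡-Reasoning
    min-first : any (occurrence ∘ (0 ∷_)) (subseqs (map suc l)) ≡ false
    min-first = begin
      any (occurrence ∘ (0 ∷_)) (subseqs (map suc l))            ≡⟨ cong (any _) (subseqs-map suc l) ⟩
      any (occurrence ∘ (0 ∷_)) (map (map suc) (subseqs l))      ≡⟨ any-map _ (map suc) (subseqs l) ⟩
      any (occurrence ∘ (0 ∷_) ∘ map suc) (subseqs l)            ≡⟨ any-false _ occurrence-min-first (subseqs l) ⟩
      false                                                      ∎
  avoids-insert-min (suc q) (y ∷ l) (s≤s q≤l) = begin
    avoids (suc y ∷ insertAt′ (map suc l) q 0)
      ≡⟨ avoids-∷ (suc y) (insertAt′ (map suc l) q 0) ⟩
    not (any (occurrence ∘ (suc y ∷_)) (subseqs (insertAt′ (map suc l) q 0))) ∧ avoids (insertAt′ (map suc l) q 0)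
      ≡⟨ cong₂ (λ a b → not a ∧ b) (any-occurrence-insert-min y q l q≤l) (avoids-insert-min q l q≤l) ⟩
    not (any (occurrence ∘ (suc y ∷_)) (subseqs (map suc l)) ∨ not i) ∧ (avoids l ∧ ((q ≡ᵇ 0) ∨ i))
      ≡⟨ cong (λ a → not (a ∨ not i) ∧ (avoids l ∧ ((q ≡ᵇ 0) ∨ i)))
              (any-occurrence-map-suc (suc y ∷_) (y ∷_) (λ _ → refl) l) ⟩
    not (a ∨ not i) ∧ (avoids l ∧ ((q ≡ᵇ 0) ∨ i))
      ≡⟨ lemma a i (avoids l) (q ≡ᵇ 0) ⟩
    (not a ∧ avoids l) ∧ i
      ≡⟨ cong (_∧ i) (avoids-∷ y l) ⟨
    avoids (y ∷ l) ∧ i ∎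
    where
    open ≡-Reasoning
    a = any (occurrence ∘ (y ∷_)) (subseqs l)
    i = increasing (drop q l)
    lemma : ∀ a i v z → not (a ∨ not i) ∧ (v ∧ (z ∨ i)) ≡ (not a ∧ v) ∧ i
    lemma true  i     v z     = refl
    lemma false false v z     = sym (Bool.∧-zeroʳ v)
    lemma false true  v z     = cong (v ∧_) (Bool.∨-zeroʳ z)

module GeneratingTree where

  open import Data.Bool using (true; false; _∧_; if_then_else_)
  import Data.Bool.Properties as Bool
  open import Data.Bool.ListAction using (all)
  open import Data.Nat as ℕ using (ℕ; zero; suc; _<ᵇ_; _<_; _≤_; z≤n; s≤s; _∸_)
  import Data.Nat.Properties as ℕ
  open import Data.Nat.ListAction using (sum)
  open import Data.List using (List; []; _∷_; map; length; drop; applyUpTo)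
  import Data.List.Properties as List
  open import Function using (_∘_)
  open import Data.Empty using (⊥-elim)
  open import Relation.Binary.PropositionalEquality
  open Lists using (increasing; increasing-drop; increasing-map-suc; all-<ᵇ-map-suc; insertAt′)

  -- The label of a permutation: full m if it is increasing of length m, and part s
  -- otherwise, s being the length of its longest increasing suffix. Inserting a new
  -- minimum in front yields firstChild; the other admissible sites, activeSites many,
  -- yield part 1, part 2, … from right to left.
  data Label : Set where
    full part : ℕ → Label

  firstChild : Label → Label
  firstChild (full m) = full (suc m)
  firstChild (part s) = part s

  activeSites : Label → ℕ
  activeSites (full m) = m
  activeSites (part s) = suc s

  children : Label → List Label
  children l = firstChild l ∷ applyUpTo (part ∘ suc) (activeSites l)

  descendants : ℕ → Label → ℕ
  descendants zero    l = 1
  descendants (suc n) l = sum (map (descendants n) (children l))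

  incSuffix : List ℕ → ℕ
  incSuffix []      = 0
  incSuffix (a ∷ l) = if increasing (a ∷ l) then suc (length l) else incSuffix l

  label : List ℕ → Label
  label u = if increasing u then full (length u) else part (incSuffix u)

  incSuffix-≤ : ∀ u → incSuffix u ≤ length u
  incSuffix-≤ []      = z≤n
  incSuffix-≤ (a ∷ l) with increasing (a ∷ l)
  ... | true  = ℕ.≤-refl
  ... | false = ℕ.m≤n⇒m≤1+n (incSuffix-≤ l)

  incSuffix-increasing : ∀ u → increasing u ≡ true → incSuffix u ≡ length u
  incSuffix-increasing []      _   = refl
  incSuffix-increasing (a ∷ l) inc rewrite inc = refl

  incSuffix-< : ∀ u → increasing u ≡ false → incSuffix u < length u
  incSuffix-< (a ∷ l) ninc rewrite ninc = s≤s (incSuffix-≤ l)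

  increasing-drop⇒ : ∀ u q → increasing (drop q u) ≡ true → length u ∸ q ≤ incSuffix u
  increasing-drop⇒ []      zero    _   = z≤n
  increasing-drop⇒ []      (suc q) _   = z≤n
  increasing-drop⇒ (a ∷ l) zero    inc rewrite inc = ℕ.≤-refl
  increasing-drop⇒ (a ∷ l) (suc q) inc with increasing (a ∷ l)
  ... | true  = ℕ.m≤n⇒m≤1+n (ℕ.m∸n≤m (length l) q)
  ... | false = increasing-drop⇒ l q inc

  increasing-drop⇐ : ∀ u q → length u ∸ q ≤ incSuffix u → increasing (drop q u) ≡ true
  increasing-drop⇐ []      zero    _ = refl
  increasing-drop⇐ []      (suc q) _ = refl
  increasing-drop⇐ (a ∷ l) q       h with increasing (a ∷ l) in e
  increasing-drop⇐ (a ∷ l) q       h | true  = increasing-drop q (a ∷ l) e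
  increasing-drop⇐ (a ∷ l) zero    h | false = ⊥-elim (ℕ.<⇒≱ (s≤s (incSuffix-≤ l)) h)
  increasing-drop⇐ (a ∷ l) (suc q) h | false = increasing-drop⇐ l q h

  activeSites-≤ : ∀ u → activeSites (label u) ≤ length u
  activeSites-≤ u with increasing u in e
  ... | true  = ℕ.≤-refl
  ... | false = incSuffix-< u e

  activeSites-sound : ∀ u j → j < activeSites (label u) → increasing (drop (length u ∸ j) u) ≡ true
  activeSites-sound u j j<k = increasing-drop⇐ u (length u ∸ j)
    (subst (_≤ incSuffix u) (sym (ℕ.m∸[m∸n]≡n j≤m)) (j≤incSuffix (increasing u) refl))
    where
    j≤m : j ≤ length u
    j≤m = ℕ.<⇒≤ (ℕ.<-≤-trans j<k (activeSites-≤ u))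
    j≤incSuffix : ∀ b → increasing u ≡ b → j ≤ incSuffix u
    j≤incSuffix true  e = subst (j ≤_) (sym (incSuffix-increasing u e)) j≤m
    j≤incSuffix false e =
      ℕ.≤-pred (subst (λ b → j < activeSites (if b then full (length u) else part (incSuffix u))) e j<k)

  activeSites-complete : ∀ u q → 1 ≤ q → q ≤ length u → increasing (drop q u) ≡ true →
                         length u ∸ q < activeSites (label u)
  activeSites-complete u q 1≤q q≤m inc with increasing u
  ... | true  = ℕ.∸-monoʳ-< {o = 0} 1≤q q≤m
  ... | false = s≤s (increasing-drop⇒ u q inc)

  all-0<ᵇ-map-suc : ∀ l → all (0 <ᵇ_) (map suc l) ≡ true
  all-0<ᵇ-map-suc []      = refl
  all-0<ᵇ-map-suc (x ∷ l) = all-0<ᵇ-map-suc l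

  increasing-min-∷ : ∀ u → increasing (0 ∷ map suc u) ≡ increasing u
  increasing-min-∷ u rewrite all-0<ᵇ-map-suc u = increasing-map-suc u

  incSuffix-map-suc : ∀ u → incSuffix (map suc u) ≡ incSuffix u
  incSuffix-map-suc []      = refl
  incSuffix-map-suc (a ∷ l) rewrite all-<ᵇ-map-suc a l | increasing-map-suc l | List.length-map suc l
                                  | incSuffix-map-suc l = refl

  incSuffix-min-∷ : ∀ u → incSuffix (0 ∷ map suc u) ≡ (if increasing u then suc (length u) else incSuffix u)
  incSuffix-min-∷ u rewrite increasing-min-∷ u | List.length-map suc u | incSuffix-map-suc u = refl

  label-insert-front : ∀ u → label (0 ∷ map suc u) ≡ firstChild (label u)
  label-insert-front u rewrite increasing-min-∷ u | incSuffix-map-suc u | List.length-map suc u with increasing u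
  ... | true  = refl
  ... | false = refl

  increasing-above-min : ∀ y l q → increasing (suc y ∷ insertAt′ l q 0) ≡ false
  increasing-above-min y l q = cong (_∧ increasing (insertAt′ l q 0)) (all-above l q)
    where
    all-above : ∀ l q → all (suc y <ᵇ_) (insertAt′ l q 0) ≡ false
    all-above l       zero    = refl
    all-above []      (suc q) = refl
    all-above (x ∷ l) (suc q) = trans (cong ((suc y <ᵇ x) ∧_) (all-above l q)) (Bool.∧-zeroʳ _)

  incSuffix-insert-min : ∀ u q → incSuffix (insertAt′ (map suc u) q 0) ≡ incSuffix (0 ∷ map suc (drop q u))
  incSuffix-insert-min u       zero    = refl
  incSuffix-insert-min []      (suc q) = refl
  incSuffix-insert-min (y ∷ u) (suc q) rewrite increasing-above-min y (map suc u) q = incSuffix-insert-min u q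

  label-insert-late : ∀ u q → 1 ≤ q → q ≤ length u → increasing (drop q u) ≡ true →
                      label (insertAt′ (map suc u) q 0) ≡ part (suc (length (drop q u)))
  label-insert-late (y ∷ u) (suc q) _ _ inc
    rewrite increasing-above-min y (map suc u) q | incSuffix-insert-min u q | incSuffix-min-∷ (drop q u) | inc = refl

  label-insert : ∀ u j → j < activeSites (label u) →
                 label (insertAt′ (map suc u) (length u ∸ j) 0) ≡ part (suc j)
  label-insert u j j<k = trans
    (label-insert-late u (length u ∸ j) (ℕ.m<n⇒0<n∸m j<m) (ℕ.m∸n≤m (length u) j) (activeSites-sound u j j<k))
    (cong (part ∘ suc) (trans (List.length-drop (length u ∸ j) u) (ℕ.m∸[m∸n]≡n (ℕ.<⇒≤ j<m))))
    where
    j<m : j < length u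
    j<m = ℕ.<-≤-trans j<k (activeSites-≤ u)

module Permutations where

  open import Data.Bool using (Bool; true; _∧_; _∨_; not)
  import Data.Bool.Properties as Bool
  open import Data.Bool.ListAction using (any)
  open import Data.Nat as ℕ using (ℕ; zero; suc; _≡ᵇ_; _<_; _≤_; z≤n; s≤s; _∸_; _+_)
  import Data.Nat.Properties as ℕ
  open import Data.Nat.ListAction using (sum)
  open import Data.Fin as Fin using (Fin; zero; suc; toℕ; punchIn; punchOut)
  import Data.Fin.Properties as Fin
  open import Data.Vec as Vec using (Vec; []; _∷_; toList; insertAt; removeAt; lookup)
  import Data.Vec.Properties as Vec
  open import Data.List as List using (List; []; _∷_; map; length; drop; applyUpTo; concatMap)
  import Data.List.Properties as List
  open import Data.List.Membership.Propositional using (_∈_; find)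
  import Data.List.Membership.Propositional.Properties as ∈
  open import Data.List.Relation.Unary.Any using (here; there)
  import Data.List.Relation.Unary.All as All
  import Data.List.Relation.Unary.All.Properties as All
  open import Data.List.Relation.Unary.AllPairs as AllPairs using ([]; _∷_)
  import Data.List.Relation.Unary.AllPairs.Properties as AllPairs
  open import Data.List.Relation.Unary.Unique.Propositional using (Unique)
  import Data.List.Relation.Unary.Unique.Propositional.Properties as Unique
  open import Data.Product using (Σ; _×_; _,_; proj₁; proj₂)
  open import Data.Empty using (⊥; ⊥-elim)
  open import Relation.Nullary using (yes; no; ¬_)
  open import Relation.Binary.PropositionalEquality
  open import Function using (_∘_; Equivalence; _↔_)
  open import Function.Properties.Inverse using (↔-sym; ↔-trans)
  open import Data.Fin.Permutation using (↔⇒≡)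
  open Lists
  open Patterns
  open GeneratingTree

  clamp : (n k : ℕ) → Fin (suc n)
  clamp n       zero    = zero
  clamp zero    (suc k) = zero
  clamp (suc n) (suc k) = suc (clamp n k)

  toℕ-clamp : ∀ n k → k ≤ n → toℕ (clamp n k) ≡ k
  toℕ-clamp n       zero    _         = refl
  toℕ-clamp (suc n) (suc k) (s≤s k≤n) = cong suc (toℕ-clamp n k k≤n)

  clamp-toℕ : ∀ n (p : Fin (suc n)) → clamp n (toℕ p) ≡ p
  clamp-toℕ n       zero    = refl
  clamp-toℕ (suc n) (suc p) = cong suc (clamp-toℕ n p)

  length-word : ∀ {n} (σ : Vec (Fin n) n) → length (word σ) ≡ n
  length-word σ = trans (List.length-map toℕ (toList σ)) (Vec.length-toList σ)

  insertMin : ∀ {n} → Vec (Fin n) n → Fin (suc n) → Vec (Fin (suc n)) (suc n)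
  insertMin τ p = insertAt (Vec.map suc τ) p zero

  word-insertMin : ∀ {n} (τ : Vec (Fin n) n) p → word (insertMin τ p) ≡ insertAt′ (map suc (word τ)) (toℕ p) 0
  word-insertMin τ p =
    trans (toℕ-insertAt (Vec.map suc τ) p zero) (cong (λ w → insertAt′ w (toℕ p) 0) (toℕ-map-suc τ))
    where
    toℕ-insertAt : ∀ {k m} (xs : Vec (Fin k) m) p v →
      map toℕ (toList (insertAt xs p v)) ≡ insertAt′ (map toℕ (toList xs)) (toℕ p) (toℕ v)
    toℕ-insertAt xs       zero    v = refl
    toℕ-insertAt (x ∷ xs) (suc p) v = cong (toℕ x ∷_) (toℕ-insertAt xs p v)
    toℕ-map-suc : ∀ {k m} (xs : Vec (Fin k) m) → map toℕ (toList (Vec.map suc xs)) ≡ map suc (map toℕ (toList xs))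
    toℕ-map-suc []       = refl
    toℕ-map-suc (x ∷ xs) = cong (suc (toℕ x) ∷_) (toℕ-map-suc xs)

  valid : ∀ {n} → Vec (Fin n) n → Bool
  valid σ = isPerm σ ∧ avoidsAll forbidden (word σ)

  admissible : ∀ {n} → Vec (Fin n) n → Fin (suc n) → Bool
  admissible τ p = (toℕ p ≡ᵇ 0) ∨ increasing (drop (toℕ p) (word τ))

  valid-insertMin : ∀ {n} (τ : Vec (Fin n) n) p → valid (insertMin τ p) ≡ valid τ ∧ admissible τ p
  valid-insertMin τ p rewrite word-insertMin τ p
    | nodup-insert-min (toℕ p) (word τ)
    | avoidsAll≡avoids (insertAt′ (map suc (word τ)) (toℕ p) 0)
    | avoids-insert-min (toℕ p) (word τ) (subst (toℕ p ≤_) (sym (length-word τ)) (ℕ.≤-pred (Fin.toℕ<n p)))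
    | avoidsAll≡avoids (word τ)
    = sym (Bool.∧-assoc (nodup (word τ)) (avoids (word τ)) _)

  labelV : ∀ {n} → Vec (Fin n) n → Label
  labelV τ = label (word τ)

  sites : ∀ {n} → Vec (Fin n) n → List (Fin (suc n))
  sites {n} τ = zero ∷ applyUpTo (λ j → clamp n (n ∸ j)) (activeSites (labelV τ))

  activeSitesV-≤ : ∀ {n} (τ : Vec (Fin n) n) → activeSites (labelV τ) ≤ n
  activeSitesV-≤ τ = subst (activeSites (labelV τ) ≤_) (length-word τ) (activeSites-≤ (word τ))

  sites-admissible : ∀ {n} (τ : Vec (Fin n) n) p → p ∈ sites τ → admissible τ p ≡ true
  sites-admissible τ .zero (here refl) = refl
  sites-admissible {n} τ p (there p∈) with ∈.∈-applyUpTo⁻ (λ j → clamp n (n ∸ j)) p∈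
  ... | j , j<k , refl rewrite toℕ-clamp n (n ∸ j) (ℕ.m∸n≤m n j) =
    trans (cong ((n ∸ j ≡ᵇ 0) ∨_) (subst (λ m → increasing (drop (m ∸ j) (word τ)) ≡ true) (length-word τ)
                                          (activeSites-sound (word τ) j j<k)))
          (Bool.∨-zeroʳ _)

  admissible-sites : ∀ {n} (τ : Vec (Fin n) n) p → admissible τ p ≡ true → p ∈ sites τ
  admissible-sites τ zero _ = here refl
  admissible-sites {n} τ (suc p) adm = there (subst (_∈ applyUpTo (λ j → clamp n (n ∸ j)) (activeSites (labelV τ)))
    (trans (cong (clamp n) (ℕ.m∸[m∸n]≡n q≤n)) (clamp-toℕ n (suc p)))
    (∈.∈-applyUpTo⁺ (λ j → clamp n (n ∸ j)) n∸q<k))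
    where
    q = toℕ (suc p)
    q≤n : q ≤ n
    q≤n = ℕ.≤-pred (Fin.toℕ<n (suc p))
    n∸q<k : n ∸ q < activeSites (labelV τ)
    n∸q<k = subst (λ m → m ∸ q < activeSites (labelV τ)) (length-word τ)
      (activeSites-complete (word τ) q (s≤s z≤n) (subst (q ≤_) (sym (length-word τ)) q≤n) adm)

  sites-unique : ∀ {n} (τ : Vec (Fin n) n) → Unique (sites τ)
  sites-unique {n} τ = All.applyUpTo⁺₁ f k zero≢ ∷ AllPairs.applyUpTo⁺₁ f k distinct
    where
    f = λ j → clamp n (n ∸ j)
    k = activeSites (labelV τ)
    toℕ-f : ∀ j → toℕ (f j) ≡ n ∸ j
    toℕ-f j = toℕ-clamp n (n ∸ j) (ℕ.m∸n≤m n j)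
    zero≢ : ∀ {j} → j < k → zero ≢ f j
    zero≢ {j} j<k e =
      ℕ.<⇒≢ (ℕ.m<n⇒0<n∸m (ℕ.<-≤-trans j<k (activeSitesV-≤ τ))) (trans (cong toℕ e) (toℕ-f j))
    distinct : ∀ {i j} → i < j → j < k → f i ≢ f j
    distinct {i} {j} i<j j<k e = ℕ.<⇒≢ i<j
      (ℕ.∸-cancelˡ-≡ (ℕ.≤-trans (ℕ.<⇒≤ i<j) j≤n) j≤n
                     (trans (sym (toℕ-f i)) (trans (cong toℕ e) (toℕ-f j))))
      where j≤n = ℕ.<⇒≤ (ℕ.<-≤-trans j<k (activeSitesV-≤ τ))

  generate : (n : ℕ) → List (Vec (Fin n) n)
  generate zero    = [] ∷ []
  generate (suc n) = concatMap (λ τ → map (insertMin τ) (sites τ)) (generate n)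

  labels-of-sites : ∀ {n} (τ : Vec (Fin n) n) → map (labelV ∘ insertMin τ) (sites τ) ≡ children (labelV τ)
  labels-of-sites {n} τ = cong₂ _∷_ front
    (trans (List.map-applyUpTo (λ j → clamp n (n ∸ j)) (labelV ∘ insertMin τ) (activeSites (labelV τ)))
           (applyUpTo-cong (activeSites (labelV τ)) _ _ late))
    where
    front : labelV (insertMin τ zero) ≡ firstChild (labelV τ)
    front = trans (cong label (word-insertMin τ zero)) (label-insert-front (word τ))
    late : ∀ j → j < activeSites (labelV τ) → labelV (insertMin τ (clamp n (n ∸ j))) ≡ part (suc j)
    late j j<k = begin
      label (word (insertMin τ (clamp n (n ∸ j))))
        ≡⟨ cong label (word-insertMin τ (clamp n (n ∸ j))) ⟩
      label (insertAt′ (map suc (word τ)) (toℕ (clamp n (n ∸ j))) 0)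
        ≡⟨ cong (λ q → label (insertAt′ (map suc (word τ)) q 0)) (toℕ-clamp n (n ∸ j) (ℕ.m∸n≤m n j)) ⟩
      label (insertAt′ (map suc (word τ)) (n ∸ j) 0)
        ≡⟨ subst (λ m → label (insertAt′ (map suc (word τ)) (m ∸ j) 0) ≡ part (suc j)) (length-word τ)
                 (label-insert (word τ) j j<k) ⟩
      part (suc j) ∎
      where open ≡-Reasoning

  sum-descendants-generate : ∀ n k → sum (map (descendants k ∘ labelV) (generate n)) ≡ descendants (n + k) (full 0)
  sum-descendants-generate zero    k = ℕ.+-identityʳ (descendants k (full 0))
  sum-descendants-generate (suc n) k = begin
    sum (map (descendants k ∘ labelV) (generate (suc n)))
      ≡⟨ sum-concatMap (descendants k ∘ labelV) (λ τ → map (insertMin τ) (sites τ)) (generate n) ⟩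
    sum (map (λ τ → sum (map (descendants k ∘ labelV) (map (insertMin τ) (sites τ)))) (generate n))
      ≡⟨ cong sum (List.map-cong one-step (generate n)) ⟩
    sum (map (descendants (suc k) ∘ labelV) (generate n))
      ≡⟨ sum-descendants-generate n (suc k) ⟩
    descendants (n + suc k) (full 0)
      ≡⟨ cong (λ m → descendants m (full 0)) (ℕ.+-suc n k) ⟩
    descendants (suc n + k) (full 0) ∎
    where
    open ≡-Reasoning
    one-step : ∀ τ → sum (map (descendants k ∘ labelV) (map (insertMin τ) (sites τ))) ≡
                     descendants (suc k) (labelV τ)
    one-step τ = cong sum (begin
      map (descendants k ∘ labelV) (map (insertMin τ) (sites τ)) ≡⟨ List.map-∘ (map (insertMin τ) (sites τ)) ⟩
      map (descendants k) (map labelV (map (insertMin τ) (sites τ)))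
        ≡⟨ cong (map (descendants k)) (List.map-∘ (sites τ)) ⟨
      map (descendants k) (map (labelV ∘ insertMin τ) (sites τ))   ≡⟨ cong (map (descendants k)) (labels-of-sites τ) ⟩
      map (descendants k) (children (labelV τ))                    ∎)

  length-generate : ∀ n → length (generate n) ≡ descendants n (full 0)
  length-generate n = begin
    length (generate n)                                   ≡⟨ length≡sum-map-1 (generate n) ⟩
    sum (map (descendants 0 ∘ labelV) (generate n))       ≡⟨ sum-descendants-generate n 0 ⟩
    descendants (n + 0) (full 0)                          ≡⟨ cong (λ m → descendants m (full 0)) (ℕ.+-identityʳ n) ⟩
    descendants n (full 0)                                ∎
    where
    open ≡-Reasoning
    length≡sum-map-1 : ∀ {A : Set} (xs : List A) → length xs ≡ sum (map (λ _ → 1) xs)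
    length≡sum-map-1 []       = refl
    length≡sum-map-1 (x ∷ xs) = cong suc (length≡sum-map-1 xs)

  generate-valid : ∀ n σ → σ ∈ generate n → valid σ ≡ true
  generate-valid zero    .[] (here refl) = refl
  generate-valid (suc n) σ σ∈
    with find (∈.∈-concatMap⁻ (λ τ → map (insertMin τ) (sites τ)) {xs = generate n} σ∈)
  ... | τ , τ∈ , σ∈′ with ∈.∈-map⁻ (insertMin τ) {xs = sites τ} σ∈′
  ... | p , p∈ , refl rewrite valid-insertMin τ p | generate-valid n τ τ∈ = sites-admissible τ p p∈

  insertMin-injective : ∀ {n} (τ τ′ : Vec (Fin n) n) p p′ →
                        insertMin τ p ≡ insertMin τ′ p′ → p ≡ p′ × τ ≡ τ′
  insertMin-injective τ τ′ p p′ e with p Fin.≟ p′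
  ... | yes refl = refl , map-suc-injective τ τ′ (begin
    Vec.map suc τ                       ≡⟨ Vec.removeAt-insertAt (Vec.map suc τ) p zero ⟨
    removeAt (insertMin τ p) p          ≡⟨ cong (λ v → removeAt v p) e ⟩
    removeAt (insertMin τ′ p) p         ≡⟨ Vec.removeAt-insertAt (Vec.map suc τ′) p zero ⟩
    Vec.map suc τ′                      ∎)
    where
    open ≡-Reasoning
    map-suc-injective : ∀ {n m} (xs ys : Vec (Fin n) m) → Vec.map Fin.suc xs ≡ Vec.map Fin.suc ys → xs ≡ ys
    map-suc-injective []       []       e = refl
    map-suc-injective (x ∷ xs) (y ∷ ys) e =
      cong₂ _∷_ (Fin.suc-injective (Vec.∷-injectiveˡ e)) (map-suc-injective xs ys (Vec.∷-injectiveʳ e))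
  ... | no p≢p′ = ⊥-elim (suc≢zero (begin
    suc (lookup τ (punchOut p≢p′))         ≡⟨ Vec.lookup-map (punchOut p≢p′) suc τ ⟨
    lookup (Vec.map suc τ) (punchOut p≢p′) ≡⟨ Vec.insertAt-punchIn (Vec.map suc τ) p zero (punchOut p≢p′) ⟨
    lookup (insertMin τ p) (punchIn p (punchOut p≢p′))
                                           ≡⟨ cong (lookup (insertMin τ p)) (Fin.punchIn-punchOut p≢p′) ⟩
    lookup (insertMin τ p) p′              ≡⟨ cong (λ v → lookup v p′) e ⟩
    lookup (insertMin τ′ p′) p′            ≡⟨ Vec.insertAt-lookup (Vec.map suc τ′) p′ zero ⟩
    zero                                   ∎))
    where
    open ≡-Reasoning
    suc≢zero : ∀ {n} {x : Fin n} → suc x ≢ zero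
    suc≢zero ()

  generate-unique : ∀ n → Unique (generate n)
  generate-unique zero    = All.[] ∷ []
  generate-unique (suc n) = Unique.concat⁺
    (All.map⁺ (All.universal
      (λ τ → Unique.map⁺ (λ {p} {p′} e → proj₁ (insertMin-injective τ τ p p′ e)) (sites-unique τ)) (generate n)))
    (AllPairs.map⁺ (AllPairs.map disjoint (generate-unique n)))
    where
    disjoint : ∀ {τ τ′} → τ ≢ τ′ → ∀ {σ} →
               ¬ (σ ∈ map (insertMin τ) (sites τ) × σ ∈ map (insertMin τ′) (sites τ′))
    disjoint {τ} {τ′} τ≢τ′ (σ∈ , σ∈′)
      with ∈.∈-map⁻ (insertMin τ) {xs = sites τ} σ∈ | ∈.∈-map⁻ (insertMin τ′) {xs = sites τ′} σ∈′
    ... | p , _ , e | p′ , _ , e′ = τ≢τ′ (proj₂ (insertMin-injective τ τ′ p p′ (trans (sym e) e′)))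

  not-fresh : ∀ {a b} → not a ∧ b ≡ true → a ≡ true → ⊥
  not-fresh {true} () refl

  any-≡ᵇ-lookup : ∀ {k m} (σ : Vec (Fin k) m) j → any (toℕ (lookup σ j) ≡ᵇ_) (map toℕ (toList σ)) ≡ true
  any-≡ᵇ-lookup (y ∷ σ) zero    =
    cong (_∨ any (toℕ y ≡ᵇ_) (map toℕ (toList σ)))
         (Equivalence.to Bool.T-≡ (ℕ.≡⇒≡ᵇ (toℕ y) (toℕ y) refl))
  any-≡ᵇ-lookup (y ∷ σ) (suc j) =
    trans (cong ((toℕ (lookup σ j) ≡ᵇ toℕ y) ∨_) (any-≡ᵇ-lookup σ j)) (Bool.∨-zeroʳ _)

  nodup⇒lookup-injective : ∀ {k m} (σ : Vec (Fin k) m) → nodup (map toℕ (toList σ)) ≡ true →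
                           ∀ i j → lookup σ i ≡ lookup σ j → i ≡ j
  nodup⇒lookup-injective (x ∷ σ) nd zero    zero    e = refl
  nodup⇒lookup-injective (x ∷ σ) nd zero    (suc j) e =
    ⊥-elim (not-fresh nd (subst (λ y → any (toℕ y ≡ᵇ_) (map toℕ (toList σ)) ≡ true) (sym e)
                                (any-≡ᵇ-lookup σ j)))
  nodup⇒lookup-injective (x ∷ σ) nd (suc i) zero    e =
    ⊥-elim (not-fresh nd (subst (λ y → any (toℕ y ≡ᵇ_) (map toℕ (toList σ)) ≡ true) e (any-≡ᵇ-lookup σ i)))
  nodup⇒lookup-injective (x ∷ σ) nd (suc i) (suc j) e =
    cong suc (nodup⇒lookup-injective σ (Bool.∧-conicalʳ _ _ nd) i j e)

  zero-position : ∀ {n} (σ : Vec (Fin (suc n)) (suc n)) → nodup (word σ) ≡ true →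
                  Σ (Fin (suc n)) (λ p → lookup σ p ≡ zero)
  zero-position {n} σ nd with Fin.any? (λ p → lookup σ p Fin.≟ zero)
  ... | yes found = found
  ... | no  none  = ⊥-elim (lookup-not-injective (λ i e → none (i , sym e)))
    where
    lookup-not-injective : (∀ i → zero ≢ lookup σ i) → ⊥
    lookup-not-injective ≢zero with Fin.pigeonhole (ℕ.n<1+n n) (λ i → punchOut (≢zero i))
    ... | i , j , i<j , e = Fin.<⇒≢ i<j (nodup⇒lookup-injective σ nd i j (begin
      lookup σ i                          ≡⟨ Fin.punchIn-punchOut (≢zero i) ⟨
      suc (punchOut (≢zero i))            ≡⟨ cong suc e ⟩
      suc (punchOut (≢zero j))            ≡⟨ Fin.punchIn-punchOut (≢zero j) ⟩
      lookup σ j                          ∎))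
      where open ≡-Reasoning

  unshift : ∀ {n m} (v : Vec (Fin (suc n)) m) → (∀ i → zero ≢ lookup v i) → Vec (Fin n) m
  unshift []      _   = []
  unshift (x ∷ v) ≢0 = punchOut (≢0 zero) ∷ unshift v (≢0 ∘ suc)

  map-suc-unshift : ∀ {n m} (v : Vec (Fin (suc n)) m) (≢0 : ∀ i → zero ≢ lookup v i) →
                    Vec.map suc (unshift v ≢0) ≡ v
  map-suc-unshift []      _   = refl
  map-suc-unshift (x ∷ v) ≢0 = cong₂ _∷_ (Fin.punchIn-punchOut (≢0 zero)) (map-suc-unshift v (≢0 ∘ suc))

  insertMin-surjective : ∀ {n} (σ : Vec (Fin (suc n)) (suc n)) → nodup (word σ) ≡ true →
                         Σ (Vec (Fin n) n) λ τ → Σ (Fin (suc n)) λ p → insertMin τ p ≡ σ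
  insertMin-surjective σ nd with zero-position σ nd
  ... | p , σp≡0 = unshift (removeAt σ p) ≢0 , p , (begin
    insertAt (Vec.map suc (unshift (removeAt σ p) ≢0)) p zero
      ≡⟨ cong (λ v → insertAt v p zero) (map-suc-unshift (removeAt σ p) ≢0) ⟩
    insertAt (removeAt σ p) p zero
      ≡⟨ cong (insertAt (removeAt σ p) p) σp≡0 ⟨
    insertAt (removeAt σ p) p (lookup σ p)
      ≡⟨ Vec.insertAt-removeAt σ p ⟩
    σ ∎)
    where
    open ≡-Reasoning
    ≢0 : ∀ i → zero ≢ lookup (removeAt σ p) i
    ≢0 i e = Fin.punchInᵢ≢i p i (nodup⇒lookup-injective σ nd (punchIn p i) p (begin
      lookup σ (punchIn p i)                 ≡⟨ Vec.removeAt-punchOut σ (Fin.punchInᵢ≢i p i ∘ sym) ⟨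
      lookup (removeAt σ p) (punchOut (Fin.punchInᵢ≢i p i ∘ sym))
                                             ≡⟨ cong (lookup (removeAt σ p)) (Fin.punchOut-punchIn p) ⟩
      lookup (removeAt σ p) i                ≡⟨ e ⟨
      zero                                   ≡⟨ σp≡0 ⟨
      lookup σ p                             ∎))

  generate-complete : ∀ n (σ : Vec (Fin n) n) → valid σ ≡ true → σ ∈ generate n
  generate-complete zero    []  _   = here refl
  generate-complete (suc n) σ   val with insertMin-surjective σ (Bool.∧-conicalˡ _ _ val)
  ... | τ , p , refl = ∈.∈-concat⁺′
    (∈.∈-map⁺ (insertMin τ) (admissible-sites τ p (Bool.∧-conicalʳ _ _ val′)))
    (∈.∈-map⁺ (λ τ → map (insertMin τ) (sites τ)) (generate-complete n τ (Bool.∧-conicalˡ _ _ val′)))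
    where
    val′ : valid τ ∧ admissible τ p ≡ true
    val′ = trans (sym (valid-insertMin τ p)) val

  generate↔C4132 : ∀ n → Fin (length (generate n)) ↔ C4132 n
  generate↔C4132 n = enumeration↔ (generate n) (generate-unique n)
    (λ σ σ∈ → Equivalence.from Bool.T-≡ (generate-valid n σ σ∈))
    (λ σ val → generate-complete n σ (Equivalence.to Bool.T-≡ val))
    (λ σ → Bool.T-irrelevant)

  C4132-count : (a : ℕ → ℕ) → (∀ n → Fin (a n) ↔ C4132 n) → ∀ n → a n ≡ descendants n (full 0)
  C4132-count a a↔C n = trans (↔⇒≡ (↔-trans (a↔C n) (↔-sym (generate↔C4132 n)))) (length-generate n)

module GeneratingFunction where

  open import Data.Nat as ℕ using (ℕ; zero; suc; s≤s)
  import Data.Nat.Properties as ℕ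
  open import Data.Nat.ListAction using (sum)
  open import Data.Integer as ℤ using (ℤ; +_; -_; _+_)
  import Data.Integer.Properties as ℤ
  open import Data.List using (applyUpTo)
  import Data.List.Properties as List
  open import Function using (_∘_)
  open import Relation.Binary.PropositionalEquality
  open import Algebra.Bundles using (CommutativeRing)
  open PowerSeries
  open GeneratingTree
  import Relation.Binary.Reasoning.Setoid (CommutativeRing.setoid seriesRing) as ≗-Reasoning

  -- Φ f = 1 + x/(1 - x)·f², written with shift to make causality visible; its fixed
  -- point D is the Catalan series evaluated at x/(1 - x).
  Φ : Series → Series
  Φ f = 𝟙 ⊕ shift (geometric ⊗ (f ⊗ f))

  Φ-causal : Causal Φ
  Φ-causal zero    _   = refl
  Φ-causal (suc k) f≗g = cong (_+_ (+ 0)) (⊗-local k (λ _ _ → refl) (λ i i≤k → ⊗-local i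
    (λ j j≤i → f≗g j (s≤s (ℕ.≤-trans j≤i i≤k))) (λ j j≤i → f≗g j (s≤s (ℕ.≤-trans j≤i i≤k)))))

  D : Series
  D = fixpoint Φ

  D-equation : D ≗ 𝟙 ⊕ X ⊗ geometric ⊗ (D ⊗ D)
  D-equation k = trans (fixpoint-unfold Φ-causal k)
    (cong (_+_ (𝟙 k)) (trans (sym (X⊗≗shift (geometric ⊗ (D ⊗ D)) k)) (sym (⊗-assoc X geometric (D ⊗ D) k))))

  open CommutativeRing seriesRing using (-‿cong) renaming (refl to ≗-refl; sym to ≗-sym)

  powerSum : ℕ → Series
  powerSum t = Σ< t (λ j → D ^ suc (suc j))

  D^-expansion : ∀ t → D ^ t ≗ 𝟙 ⊕ X ⊗ geometric ⊗ powerSum t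
  D^-expansion zero    k = sym (trans (cong (_+_ (𝟙 k)) (⊗-zeroʳ (X ⊗ geometric) k)) (ℤ.+-identityʳ (𝟙 k)))
  D^-expansion (suc t) = begin
    D ⊗ D ^ t
      ≈⟨ ⊗-congʳ (D ^ t) D-equation ⟩
    (𝟙 ⊕ X ⊗ geometric ⊗ (D ⊗ D)) ⊗ D ^ t
      ≈⟨ solve 4 (λ x g d p → (con (+ 1) :+ x :* g :* (d :* d)) :* p := p :+ x :* g :* (d :* (d :* p)))
               ≗-refl X geometric D (D ^ t) ⟩
    D ^ t ⊕ X ⊗ geometric ⊗ D ^ suc (suc t)
      ≈⟨ ⊕-congʳ (X ⊗ geometric ⊗ D ^ suc (suc t)) (D^-expansion t) ⟩
    (𝟙 ⊕ X ⊗ geometric ⊗ powerSum t) ⊕ X ⊗ geometric ⊗ D ^ suc (suc t)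
      ≈⟨ solve 4 (λ x g s q → (con (+ 1) :+ x :* g :* s) :+ x :* g :* q := con (+ 1) :+ x :* g :* (s :+ q))
               ≗-refl X geometric (powerSum t) (D ^ suc (suc t)) ⟩
    𝟙 ⊕ X ⊗ geometric ⊗ powerSum (suc t) ∎
    where open ≗-Reasoning

  partSeries : ℕ → Series
  partSeries s = geometric ⊗ D ^ suc s

  Σ<-partSeries : ∀ t → Σ< t (partSeries ∘ suc) ≗ geometric ⊗ powerSum t
  Σ<-partSeries t = ≗-sym (⊗-distribˡ-Σ< geometric t (λ j → D ^ suc (suc j)))

  partSeries-equation : ∀ s → partSeries s ≗ 𝟙 ⊕ X ⊗ (partSeries s ⊕ Σ< (suc s) (partSeries ∘ suc))
  partSeries-equation s = begin
    geometric ⊗ P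
      ≈⟨ ⊗-congʳ P geometric-equation ⟩
    (𝟙 ⊕ X ⊗ geometric) ⊗ P
      ≈⟨ solve 3 (λ x g p → (con (+ 1) :+ x :* g) :* p := p :+ x :* (g :* p)) ≗-refl X geometric P ⟩
    P ⊕ X ⊗ (geometric ⊗ P)
      ≈⟨ ⊕-congʳ (X ⊗ (geometric ⊗ P)) (D^-expansion (suc s)) ⟩
    (𝟙 ⊕ X ⊗ geometric ⊗ S) ⊕ X ⊗ (geometric ⊗ P)
      ≈⟨ solve 4 (λ x g s p → (con (+ 1) :+ x :* g :* s) :+ x :* (g :* p) := con (+ 1) :+ x :* (g :* p :+ g :* s))
               ≗-refl X geometric S P ⟩
    𝟙 ⊕ X ⊗ (geometric ⊗ P ⊕ geometric ⊗ S)
      ≈⟨ 𝟙⊕X⊗-cong (⊕-congˡ (geometric ⊗ P) (≗-sym (Σ<-partSeries (suc s)))) ⟩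
    𝟙 ⊕ X ⊗ (partSeries s ⊕ Σ< (suc s) (partSeries ∘ suc)) ∎
    where
    open ≗-Reasoning
    P = D ^ suc s
    S = powerSum (suc s)

  +descendants-suc : ∀ k l → + descendants (suc k) l ≡
    + descendants k (firstChild l) + + sum (applyUpTo (descendants k ∘ part ∘ suc) (activeSites l))
  +descendants-suc k l = trans
    (cong (λ xs → + (descendants k (firstChild l) ℕ.+ sum xs))
          (List.map-applyUpTo (part ∘ suc) (descendants k) (activeSites l)))
    (ℤ.pos-+ (descendants k (firstChild l)) _)

  descendants-part≡partSeries : ∀ k s → + descendants k (part s) ≡ partSeries s k
  descendants-part≡partSeries zero    s =
    sym (trans (partSeries-equation s 0) (𝟙⊕X⊗-coefficient-zero (partSeries s ⊕ Σ< (suc s) (partSeries ∘ suc))))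
  descendants-part≡partSeries (suc k) s = begin
    + descendants (suc k) (part s)
      ≡⟨ +descendants-suc k (part s) ⟩
    + descendants k (part s) + + sum (applyUpTo (descendants k ∘ part ∘ suc) (suc s))
      ≡⟨ cong₂ _+_ (descendants-part≡partSeries k s) (sym Σ<-coefficient-k) ⟩
    partSeries s k + Σ< (suc s) (partSeries ∘ suc) k
      ≡⟨ 𝟙⊕X⊗-coefficient-suc (partSeries s ⊕ Σ< (suc s) (partSeries ∘ suc)) k ⟨
    (𝟙 ⊕ X ⊗ (partSeries s ⊕ Σ< (suc s) (partSeries ∘ suc))) (suc k)
      ≡⟨ partSeries-equation s (suc k) ⟨
    partSeries s (suc k) ∎
    where
    open ≡-Reasoning
    Σ<-coefficient-k : Σ< (suc s) (partSeries ∘ suc) k ≡ + sum (applyUpTo (descendants k ∘ part ∘ suc) (suc s))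
    Σ<-coefficient-k =
      Σ<-coefficient (suc s) (partSeries ∘ suc) _ k (λ j → sym (descendants-part≡partSeries k (suc j)))

  Σ<-partSeries-coefficient : ∀ k t →
    Σ< t (partSeries ∘ suc) k ≡ + sum (applyUpTo (descendants k ∘ part ∘ suc) t)
  Σ<-partSeries-coefficient k t =
    Σ<-coefficient t (partSeries ∘ suc) _ k (λ j → sym (descendants-part≡partSeries k (suc j)))

  fullSeries : ℕ → Series
  fullSeries t k = + descendants k (full t)

  fullSeries-equation : ∀ t → fullSeries t ≗ 𝟙 ⊕ X ⊗ (fullSeries (suc t) ⊕ geometric ⊗ powerSum t)
  fullSeries-equation t zero    = sym (𝟙⊕X⊗-coefficient-zero (fullSeries (suc t) ⊕ geometric ⊗ powerSum t))
  fullSeries-equation t (suc k) = begin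
    + descendants (suc k) (full t)
      ≡⟨ +descendants-suc k (full t) ⟩
    fullSeries (suc t) k + + sum (applyUpTo (descendants k ∘ part ∘ suc) t)
      ≡⟨ cong (_+_ (fullSeries (suc t) k))
              (trans (sym (Σ<-partSeries-coefficient k t)) (Σ<-partSeries t k)) ⟩
    fullSeries (suc t) k + (geometric ⊗ powerSum t) k
      ≡⟨ sym (𝟙⊕X⊗-coefficient-suc _ k) ⟩
    (𝟙 ⊕ X ⊗ (fullSeries (suc t) ⊕ geometric ⊗ powerSum t)) (suc k) ∎
    where open ≡-Reasoning

  -- (1 - xD) F_t - D^t is divisible by x, with quotient the same expression at t + 1.
  [𝟙⊖X⊗D]⊗fullSeries : (𝟙 ⊕ ⊖ (X ⊗ D)) ⊗ fullSeries 0 ≗ 𝟙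
  [𝟙⊖X⊗D]⊗fullSeries k = ℤ.i-j≡0⇒i≡j _ _ (X-divisible≗𝟘 E E-step 0 k)
    where
    E : ℕ → Series
    E t = (𝟙 ⊕ ⊖ (X ⊗ D)) ⊗ fullSeries t ⊕ ⊖ (D ^ t)
    E-step : ∀ t → E t ≗ X ⊗ E (suc t)
    E-step t = begin
      (𝟙 ⊕ ⊖ (X ⊗ D)) ⊗ fullSeries t ⊕ ⊖ (D ^ t)
        ≈⟨ ⊕-cong (⊗-congˡ (𝟙 ⊕ ⊖ (X ⊗ D)) (fullSeries-equation t)) (-‿cong (D^-expansion t)) ⟩
      (𝟙 ⊕ ⊖ (X ⊗ D)) ⊗ (𝟙 ⊕ X ⊗ (fullSeries (suc t) ⊕ geometric ⊗ powerSum t))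
        ⊕ ⊖ (𝟙 ⊕ X ⊗ geometric ⊗ powerSum t)
        ≈⟨ solve 5 (λ x d f g s →
             (con (+ 1) :+ :- (x :* d)) :* (con (+ 1) :+ x :* (f :+ g :* s)) :+ :- (con (+ 1) :+ x :* g :* s)
             := x :* ((con (+ 1) :+ :- (x :* d)) :* f :+ :- (d :* (con (+ 1) :+ x :* g :* s))))
           ≗-refl X D (fullSeries (suc t)) geometric (powerSum t) ⟩
      X ⊗ ((𝟙 ⊕ ⊖ (X ⊗ D)) ⊗ fullSeries (suc t) ⊕ ⊖ (D ⊗ (𝟙 ⊕ X ⊗ geometric ⊗ powerSum t)))
        ≈⟨ ⊗-congˡ X (⊕-congˡ ((𝟙 ⊕ ⊖ (X ⊗ D)) ⊗ fullSeries (suc t))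
                              (-‿cong (⊗-congˡ D (≗-sym (D^-expansion t))))) ⟩
      X ⊗ E (suc t) ∎
      where open ≗-Reasoning

  D-quadratic : (𝟙 ⊕ ⊖ X) ⊗ D ≗ (𝟙 ⊕ ⊖ X) ⊕ X ⊗ D ⊗ D
  D-quadratic = begin
    (𝟙 ⊕ ⊖ X) ⊗ D
      ≈⟨ ⊗-congˡ (𝟙 ⊕ ⊖ X) D-equation ⟩
    (𝟙 ⊕ ⊖ X) ⊗ (𝟙 ⊕ X ⊗ geometric ⊗ (D ⊗ D))
      ≈⟨ solve 3 (λ x g d → (con (+ 1) :+ :- x) :* (con (+ 1) :+ x :* g :* (d :* d))
                          := (con (+ 1) :+ :- x) :+ x :* d :* d :* (g :+ :- (x :* g))) ≗-refl X geometric D ⟩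
    (𝟙 ⊕ ⊖ X) ⊕ X ⊗ D ⊗ D ⊗ (geometric ⊕ ⊖ (X ⊗ geometric))
      ≈⟨ ⊕-congˡ (𝟙 ⊕ ⊖ X) (⊗-congˡ (X ⊗ D ⊗ D) (⊕-congʳ (⊖ (X ⊗ geometric)) geometric-equation)) ⟩
    (𝟙 ⊕ ⊖ X) ⊕ X ⊗ D ⊗ D ⊗ ((𝟙 ⊕ X ⊗ geometric) ⊕ ⊖ (X ⊗ geometric))
      ≈⟨ solve 3 (λ x g d → (con (+ 1) :+ :- x) :+ x :* d :* d :* ((con (+ 1) :+ x :* g) :+ :- (x :* g))
                          := (con (+ 1) :+ :- x) :+ x :* d :* d) ≗-refl X geometric D ⟩
    (𝟙 ⊕ ⊖ X) ⊕ X ⊗ D ⊗ D ∎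
    where open ≗-Reasoning

  S : Series
  S = (𝟙 ⊕ ⊖ X) ⊕ ⊖ (const (+ 2) ⊗ X ⊗ D)

  S⊗S : S ⊗ S ≗ (𝟙 ⊕ const (- + 1) ⊗ X) ⊗ (𝟙 ⊕ const (- + 5) ⊗ X)
  S⊗S = begin
    S ⊗ S
      ≈⟨ solve 2 (λ x d → s x d :* s x d := δ x :+ con (+ 4) :* x :* ((x :* d :* d :+ u x) :+ :- (u x :* d)))
               ≗-refl X D ⟩
    δ′ ⊕ const (+ 4) ⊗ X ⊗ ((X ⊗ D ⊗ D ⊕ (𝟙 ⊕ ⊖ X)) ⊕ ⊖ ((𝟙 ⊕ ⊖ X) ⊗ D))
      ≈⟨ ⊕-congˡ δ′ (⊗-congˡ (const (+ 4) ⊗ X)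
                              (⊕-congˡ (X ⊗ D ⊗ D ⊕ (𝟙 ⊕ ⊖ X)) (-‿cong D-quadratic))) ⟩
    δ′ ⊕ const (+ 4) ⊗ X ⊗ ((X ⊗ D ⊗ D ⊕ (𝟙 ⊕ ⊖ X)) ⊕ ⊖ ((𝟙 ⊕ ⊖ X) ⊕ X ⊗ D ⊗ D))
      ≈⟨ solve 2 (λ x d → δ x :+ con (+ 4) :* x :* ((x :* d :* d :+ u x) :+ :- (u x :+ x :* d :* d)) := δ x)
               ≗-refl X D ⟩
    δ′ ∎
    where
    open ≗-Reasoning
    u = λ x → con (+ 1) :+ :- x
    s = λ x d → u x :+ :- (con (+ 2) :* x :* d)
    δ = λ x → (con (+ 1) :+ con (- + 1) :* x) :* (con (+ 1) :+ con (- + 5) :* x)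
    δ′ = (𝟙 ⊕ const (- + 1) ⊗ X) ⊗ (𝟙 ⊕ const (- + 5) ⊗ X)

  S⊛S≗disc : S ⊛ S ≗ disc
  S⊛S≗disc n = trans (⊛≗⊗ S S n) (trans (S⊗S n) (sym (trans (⊛≗⊗ _ _ n)
    (⊗-cong (⊕-congˡ 𝟙 (scaleX≗const⊗X (- + 1))) (⊕-congˡ 𝟙 (scaleX≗const⊗X (- + 5))) n))))

  fullSeries⊗[𝟙⊕X⊕S] : fullSeries 0 ⊗ (𝟙 ⊕ (X ⊕ S)) ≗ const (+ 2)
  fullSeries⊗[𝟙⊕X⊕S] = begin
    fullSeries 0 ⊗ (𝟙 ⊕ (X ⊕ S))
      ≈⟨ solve 3 (λ f x d → f :* (con (+ 1) :+ (x :+ ((con (+ 1) :+ :- x) :+ :- (con (+ 2) :* x :* d))))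
                          := con (+ 2) :* ((con (+ 1) :+ :- (x :* d)) :* f)) ≗-refl (fullSeries 0) X D ⟩
    const (+ 2) ⊗ ((𝟙 ⊕ ⊖ (X ⊗ D)) ⊗ fullSeries 0)
      ≈⟨ ⊗-congˡ (const (+ 2)) [𝟙⊖X⊗D]⊗fullSeries ⟩
    const (+ 2) ⊗ 𝟙
      ≈⟨ solve 0 (con (+ 2) :* con (+ 1) := con (+ 2)) ≗-refl ⟩
    const (+ 2) ∎
    where open ≗-Reasoning

open PowerSeries using (𝟙; ⊛≗⊗; ⊗-congʳ)
open Permutations using (C4132-count)
open GeneratingFunction using (S; S⊛S≗disc; fullSeries⊗[𝟙⊕X⊕S])

mainTheorem5 : (a : ℕ → ℕ) → (∀ n → Fin (a n) ↔ C4132 n) →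
  Σ Series (λ S → (S 0 ≡ + 1) × (∀ n → (S ⊛ S) n ≡ disc n) ×
    (∀ n → ((λ k → + (a k)) ⊛ (const (+ 1) ⊕ (X ⊕ S))) n ≡ const (+ 2) n))
mainTheorem5 a a↔C = S , refl , S⊛S≗disc , a⊛[𝟙⊕X⊕S]≗2
  where
  a⊛[𝟙⊕X⊕S]≗2 : ∀ n → ((λ k → + (a k)) ⊛ (𝟙 ⊕ (X ⊕ S))) n ≡ const (+ 2) n
  a⊛[𝟙⊕X⊕S]≗2 n = trans (⊛≗⊗ _ _ n)
    (trans (⊗-congʳ (𝟙 ⊕ (X ⊕ S)) (λ k → cong +_ (C4132-count a a↔C k)) n) (fullSeries⊗[𝟙⊕X⊕S] n))
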